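{- Let $a,b$ be positive integers and let $t,s,m_t,m_s$ be positive integers with $tm_t+sm_s=b$, $t>s+1$ and $s>1$. Let $\lambda=(t^{m_t},s^{m_s})$ be the partition of $b$ with $m_t$ parts equal to $t$ and $m_s$ parts equal to $s$, and put $\lambda'_1=m_t+m_s$. Put $Y_0=0$, $Y_i=\lambda_1+\dots+\lambda_i$, and $$F_\lambda(q)=q^{2\sum_{i\geq 1}\binom{\lambda_i}{2}} \prod_{j\geq 1} \binom{j(a+2)-Y_{j-1}-Y_{j+1}}{\lambda_j-\lambda_{j+1}}_q .$$ Suppose that $\lambda'_1(s-1)$ divides $2(b-\lambda'_1)$ and that $t-s-1$ divides $2(t-1)$, and set $$A=\frac{2(t-1)}{t-s-1},\qquad B=\frac{2(b-\lambda'_1)}{\lambda'_1(s-1)}.$$ Then $F_\lambda(q)$ is the generating function (by size) for all MacMahon diagrams $\Upsilon$ of length $b$, contained inside an $a\times b$ rectangle, satisfying: (1) $\Upsilon$ has exactly $s\lambda'_1$ unmarked rows, of lengths $\mu_1\ge\mu_2\ge\dots\ge\mu_{s\lambda'_1}$, such that $\mu_{i\lambda'_1+1}-\mu_{\lambda'_1(i+1)}\le1$ for all $i=0,1,\dots,s-1$, and $\mu_i-\mu_{i+\lambda'_1}\ge B$ for all $i=1,2,\dots,\lambda'_1(s-1)$; (2) $\Upsilon$ has exactly $m_t(t-s)$ marked rows, of lengths $\nu_1\ge\nu_2\ge\dots\ge\nu_{m_t(t-s)}$, such that $\nu_{im_t+1}-\nu_{m_t(i+1)}\le1$ for all $i=0,1,\dots,t-s-1$,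 and $\nu_i-\nu_{i+m_t}\ge A$ for all $i=1,2,\dots,m_t(t-s-1)$.
   Context: $\binom{n}{m}_q$ denotes the Gaussian polynomial ($q$-binomial coefficient). Modular diagrams (nonstandard definition): Fix a partition $\mu$ and positive integers $k\ge l(\mu)$ and $N$. An $N$-modular diagram of length $k$ consists of $k$ rows, the $i$-th row having length $\mu_i\ge 0$ (rows of length zero allowed), drawn as the Ferrers diagram of $\mu$ with a zeroth column of $k$ cells added on the left (so row $i$ has $\mu_i+1$ cells). Every cell is labeled with an integer between $1$ and $N$, every cell of a row other than its rightmost cell is labeled $N$, and labels in each column weakly decrease from top to bottom. A row is labeled $i$ if its rightmost cell (the zeroth cell if the row has length zero) is labeled $i$. The length of a row is $\mu_i$, and the size of the diagram is $\sum_i\mu_i$; generating functions count diagrams by $q^{\text{size}}$. The diagram is contained inside an $a\times b$ rectangle if it has length $b$ and all row lengths are at most $a$. A MacMahon diagram is a $2$-modular diagram in which cells labeled $2$ are called unmarked and cells labeled $1$ are called marked; a row is marked (resp. unmarked) if it is labeled $1$ (resp. $2$). -}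

module Defs where

open import Data.Nat using (ℕ; zero; suc; _+_; _*_; _∸_; _≤_; _<_; _≡ᵇ_; _<ᵇ_)
open import Data.Nat.Combinatorics using (_C_)
open import Data.Integer using (ℤ; +_; -[1+_])
import Data.Integer as ℤ
open import Data.Bool using (if_then_else_)
open import Data.Nat.ListAction using (sum)
open import Data.List using (List; []; _∷_; map; upTo; take; length; replicate; _++_; foldr)
open import Data.Vec using (Vec; lookup; toList)
import Data.Vec as Vec
open import Data.Fin using (Fin; toℕ)
import Data.Fin as Fin
open import Data.Product using (_×_; Σ; ∃)
open import Relation.Binary.PropositionalEquality using (_≡_)

-- Polynomials in q with natural-number coefficients, represented by
-- their coefficient function: (f n) = coefficient of q^n.

Poly : Set
Poly = ℕ → ℕ

zeroP : Poly
zeroP _ = 0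

oneP : Poly
oneP zero    = 1
oneP (suc _) = 0

_+P_ : Poly → Poly → Poly
(f +P g) n = f n + g n

_*P_ : Poly → Poly → Poly
(f *P g) n = sum (map (λ k → f k * g (n ∸ k)) (upTo (suc n)))

shiftP : ℕ → Poly → Poly
shiftP e f n = if n <ᵇ e then 0 else f (n ∸ e)

prodP : List Poly → Poly
prodP = foldr _*P_ oneP

gauss : ℕ → ℕ → Poly
gauss n       zero    = oneP
gauss zero    (suc k) = zeroP
gauss (suc n) (suc k) = gauss n k +P shiftP (suc k) (gauss n (suc k))

-- Gaussian polynomial with integer top argument: [n, 0] = 1 and
-- [n, k] = 0 for n < 0 < k (convention).
gaussℤ : ℤ → ℕ → Poly
gaussℤ (+ n)    k       = gauss n k
gaussℤ -[1+ n ] zero    = oneP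
gaussℤ -[1+ n ] (suc k) = zeroP

-- Partitions as weakly decreasing lists; 1-indexed parts (0 beyond).

_!_ : List ℕ → ℕ → ℕ
[]       ! _             = 0
(x ∷ xs) ! zero          = 0
(x ∷ xs) ! suc zero      = x
(x ∷ xs) ! suc (suc n)   = xs ! suc n

Y : List ℕ → ℕ → ℕ
Y λs i = sum (take i λs)

-- F_λ(q) = q^{2 Σ binom(λ_i,2)} ∏_{j ≥ 1} [ j(a+2) - Y_{j-1} - Y_{j+1} , λ_j - λ_{j+1} ]_q
-- (factors with j > length λ are [n, 0] = 1, so the product is over j = 1..ℓ(λ)).
F : ℕ → List ℕ → Poly
F a λs = shiftP (2 * sum (map (λ x → x C 2) λs))
  (prodP (map (λ i → factor (suc i)) (upTo (length λs))))
  where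
  factor : ℕ → Poly
  factor j = gaussℤ ((+ (j * (a + 2)) ℤ.- + Y λs (j ∸ 1)) ℤ.- + Y λs (suc j))
                    ((λs ! j) ∸ (λs ! suc j))

-- Row i (i : Fin b, top to bottom) has length len[i]; its cells are the
-- columns 0 .. len[i]; the rightmost cell (column len[i]) carries the row
-- label lab[i] ∈ {1..N}; all other cells are labeled N.

cellLabel : (N : ℕ) {b : ℕ} → Vec ℕ b → Vec ℕ b → Fin b → ℕ → ℕ
cellLabel N len lab i c = if c ≡ᵇ lookup len i then lookup lab i else N

record ModularDiagram (N a b : ℕ) : Set where
  constructor mkDiagram
  field
    len : Vec ℕ b
    lab : Vec ℕ b
    .lab-range  : ∀ (i : Fin b) → 1 ≤ lookup lab i × lookup lab i ≤ N
    .len-dec    : ∀ (i j : Fin b) → i Fin.≤ j → lookup len j ≤ lookup len i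
    .len-bound  : ∀ (i : Fin b) → lookup len i ≤ a
    -- labels weakly decrease down each column (c ranges over the columns
    -- where both rows i < i' have a cell)
    .col-dec    : ∀ (i i' : Fin b) (c : ℕ) → i Fin.< i' → c ≤ lookup len i' →
                  cellLabel N len lab i' c ≤ cellLabel N len lab i c
open ModularDiagram public

size : ∀ {N a b} → ModularDiagram N a b → ℕ
size d = sum (toList (len d))

rowsLabeled : ∀ {N a b} → ℕ → ModularDiagram N a b → List ℕ
rowsLabeled ℓ d = go (toList (len d)) (toList (lab d))
  where
  go : List ℕ → List ℕ → List ℕ
  go (x ∷ xs) (y ∷ ys) = if y ≡ᵇ ℓ then x ∷ go xs ys else go xs ys
  go _ _ = []

-- MacMahon diagrams: 2-modular; label 1 = marked, label 2 = unmarked.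
MacMahon : ℕ → ℕ → Set
MacMahon a b = ModularDiagram 2 a b

unmarkedRows markedRows : ∀ {a b} → MacMahon a b → List ℕ
unmarkedRows = rowsLabeled 2
markedRows   = rowsLabeled 1

RowCondition : (r L D : ℕ) → List ℕ → Set
RowCondition r L D μ =
  (length μ ≡ r * L) ×
  ((i : ℕ) → i < r → μ ! (i * L + 1) ≤ μ ! (L * (i + 1)) + 1) ×
  ((i : ℕ) → 1 ≤ i → i ≤ L * (r ∸ 1) → μ ! (i + L) + D ≤ μ ! i)

twoRect : (t mt s ms : ℕ) → List ℕ
twoRect t mt s ms = replicate mt t ++ replicate ms s

-- A MacMahon diagram is the same as the pair of partitions formed by its marked and its
-- unmarked rows: the column condition only says that rows are ordered by length, unmarked
-- before marked among rows of equal length, so the diagram is recovered by merging the two.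
-- A partition with r·L parts satisfying the row condition with gap D splits into r blocks of
-- L consecutive parts, each balanced (its parts differ by at most one) and therefore determined
-- by its sum; consecutive block sums differ by at least D·L. Subtracting the staircase
-- D·L·(r−1, …, 1, 0) from the block sums leaves an arbitrary partition with r parts in
-- [0, a·L − D·L·(r−1)], which the Gaussian polynomial counts; the staircase contributes the
-- factor q^{D·L·binom(r,2)}. For λ = (t^{m_t}, s^{m_s}) every factor of F_λ is 1 except at
-- j = m_t and j = m_t + m_s, and the relations defining A and B turn these two factors and
-- the exponent into exactly the two shifted Gaussian polynomials (with r = t − s, L = m_t, D = A
-- and r = s, L = m_t + m_s, D = B). When a box has negative width both sides vanish.

module Submission where

open import Defs
open import Data.Bool using (Bool; true; false; T; if_then_else_)
open import Data.Bool.Properties using (T-≡)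
open import Data.Empty using (⊥-elim; ⊥-elim-irr)
open import Data.Fin using (Fin; toℕ; fromℕ<) renaming (zero to fzero; suc to fsuc)
import Data.Fin as Fin
import Data.Fin.Properties as Finₚ
open import Data.Integer using (ℤ; _⊖_) renaming (+_ to pos)
import Data.Integer as ℤ
import Data.Integer.Properties as ℤₚ
open import Data.Irrelevant using (Irrelevant; [_])
open import Data.List
  using (List; []; _∷_; _++_; map; applyUpTo; upTo; length; replicate; take; drop; reverse; reverseAcc)
open import Data.List.Properties
  using ( map-upTo; map-applyUpTo; map-cong; map-++; map-replicate; length-map; length-replicate; length-++
        ; length-take; length-drop; length-reverse; take++drop≡id; take-all; reverse-involutive; ≡-dec)
open import Data.List.Relation.Binary.Permutation.Propositional using (↭-sym)
open import Data.List.Relation.Binary.Permutation.Propositional.Properties using (↭-reverse; All-resp-↭)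
open import Data.List.Relation.Unary.All using (All; []; _∷_)
import Data.List.Relation.Unary.All as All
import Data.List.Relation.Unary.All.Properties as All
open import Data.List.Relation.Unary.AllPairs using (AllPairs; []; _∷_)
open import Data.List.Relation.Unary.Linked using (Linked; []; [-]; _∷_)
import Data.List.Relation.Unary.Linked as Linked
import Data.List.Relation.Unary.Linked.Properties as Linked
open import Data.Nat
  using ( ℕ; zero; suc; pred; _+_; _*_; _∸_; _≤_; _<_; _≥_; _≤?_; _<?_; _≟_; _<ᵇ_; _≤ᵇ_; _≡ᵇ_
        ; z≤n; s≤s; s≤s⁻¹; z<s; NonZero; >-nonZero; >-nonZero⁻¹)
open import Data.Nat.Combinatorics using (_C_; nCk+nC[k+1]≡[n+1]C[k+1]; nC1≡n)
open import Data.Nat.DivMod using (_/_; _%_; m≡m%n+[m/n]*n; m%n<n; [m+kn]%n≡m%n; m<n⇒m%n≡m)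
open import Data.Nat.ListAction using (sum)
open import Data.Nat.ListAction.Properties using (sum-++; sum-↭)
open import Data.Nat.Properties
open import Algebra.Properties.CommutativeSemigroup +-commutativeSemigroup using (x∙yz≈y∙xz; interchange)
open import Data.Nat.Tactic.RingSolver using (solve-∀)
open import Data.Product using (Σ; _×_; _,_; proj₁; proj₂)
import Data.Product as Product
import Data.Product.Properties as Product
open import Data.Product.Function.Dependent.Propositional using (Σ-↔)
open import Data.Product.Function.NonDependent.Propositional using (_×-↔_)
open import Data.Sum using (_⊎_; inj₁; inj₂; [_,_]′)
open import Data.Sum.Function.Propositional using (_⊎-↔_)
open import Data.Unit using (⊤; tt)
open import Data.Vec using (Vec; []; _∷_)
import Data.Vec as Vec
open import Function.Base using (_∘_; _$_; flip)
open import Function.Bundles using (_↔_; Inverse; Equivalence; mk↔ₛ′)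
open import Function.Properties.Inverse using (↔-refl; ↔-sym; ↔-trans)
open import Relation.Binary.Definitions using (DecidableEquality)
open import Relation.Binary.PropositionalEquality
  using (_≡_; refl; sym; trans; cong; cong₂; subst; subst₂; module ≡-Reasoning)
open import Relation.Nullary using (¬_; Dec; yes; no)
open import Relation.Nullary.Decidable using (recompute)
open import Relation.Nullary.Reflects using (Reflects; ofʸ; ofⁿ)

≡-recompute : {A : Set} → DecidableEquality A → {x y : A} → .(x ≡ y) → x ≡ y
≡-recompute _≟_ = recompute (_ ≟ _)

Σ-≡-irrelevant : {X : Set} {P : X → Set} {x y : X} {p : Irrelevant (P x)} {q : Irrelevant (P y)} →
                 x ≡ y → _≡_ {A = Σ X (λ z → Irrelevant (P z))} (x , p) (y , q)
Σ-≡-irrelevant refl = refl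

¬⇒↔Fin : {A : Set} {m : ℕ} → ¬ A → m ≡ 0 → A ↔ Fin m
¬⇒↔Fin ¬a refl = mk↔ₛ′ (λ a → ⊥-elim (¬a a)) (λ ()) (λ ()) (λ a → ⊥-elim (¬a a))

Fin-cong : {m n : ℕ} → m ≡ n → Fin m ↔ Fin n
Fin-cong refl = ↔-refl

Fin-sum-applyUpTo : (f : ℕ → ℕ) (m : ℕ) → Fin (sum (applyUpTo f m)) ↔ Σ (Fin m) (λ k → Fin (f (toℕ k)))
Fin-sum-applyUpTo f zero    = ↔-sym (¬⇒↔Fin (λ ()) refl)
Fin-sum-applyUpTo f (suc m) =
  ↔-trans Finₚ.+↔⊎ (↔-trans (↔-refl ⊎-↔ Fin-sum-applyUpTo (f ∘ suc) m) (↔-sym Σ-Fin-suc))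
  where
  Σ-Fin-suc : {B : Fin (suc m) → Set} → Σ (Fin (suc m)) B ↔ (B fzero ⊎ Σ (Fin m) (λ k → B (fsuc k)))
  Σ-Fin-suc = mk↔ₛ′ (λ { (fzero , b) → inj₁ b ; (fsuc k , b) → inj₂ (k , b) })
                    (λ { (inj₁ b) → fzero , b ; (inj₂ (k , b)) → fsuc k , b })
                    (λ { (inj₁ _) → refl ; (inj₂ _) → refl })
                    (λ { (fzero , _) → refl ; (fsuc _ , _) → refl })

-- Generating functions of sized types

Fiber : (X : Set) → (X → ℕ) → ℕ → Set
Fiber X size n = Σ X (λ x → Irrelevant (size x ≡ n))

HasGF : (X : Set) → (X → ℕ) → Poly → Set
HasGF X size P = ∀ n → Fiber X size n ↔ Fin (P n)

module _ {X Y : Set} {sizeX : X → ℕ} {sizeY : Y → ℕ} where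

  Fiber-↔ : (f : X ↔ Y) → (∀ x → sizeY (Inverse.to f x) ≡ sizeX x) →
            ∀ n → Fiber X sizeX n ↔ Fiber Y sizeY n
  Fiber-↔ f size-to n = mk↔ₛ′ to′ from′ to∘from from∘to
    where
    open Inverse f
    to′ : Fiber X sizeX n → Fiber Y sizeY n
    to′ (x , [ p ]) = to x , [ trans (size-to x) p ]
    from′ : Fiber Y sizeY n → Fiber X sizeX n
    from′ (y , [ p ]) = from y , [ trans (sym (size-to (from y))) (trans (cong sizeY (strictlyInverseˡ y)) p) ]
    to∘from : ∀ y → to′ (from′ y) ≡ y
    to∘from (y , _) = Σ-≡-irrelevant (strictlyInverseˡ y)
    from∘to : ∀ x → from′ (to′ x) ≡ x
    from∘to (x , _) = Σ-≡-irrelevant (strictlyInverseʳ x)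

  HasGF-↔ : {P : Poly} (f : X ↔ Y) → (∀ x → sizeY (Inverse.to f x) ≡ sizeX x) →
            HasGF Y sizeY P → HasGF X sizeX P
  HasGF-↔ f size-to gf n = ↔-trans (Fiber-↔ f size-to n) (gf n)

  Fiber-⊎ : ∀ n → Fiber (X ⊎ Y) [ sizeX , sizeY ]′ n ↔ (Fiber X sizeX n ⊎ Fiber Y sizeY n)
  Fiber-⊎ n = mk↔ₛ′ (λ { (inj₁ x , p) → inj₁ (x , p) ; (inj₂ y , p) → inj₂ (y , p) })
                    (λ { (inj₁ (x , p)) → inj₁ x , p ; (inj₂ (y , p)) → inj₂ y , p })
                    (λ { (inj₁ _) → refl ; (inj₂ _) → refl })
                    (λ { (inj₁ _ , _) → refl ; (inj₂ _ , _) → refl })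

  HasGF-⊎ : {P Q : Poly} → HasGF X sizeX P → HasGF Y sizeY Q → HasGF (X ⊎ Y) [ sizeX , sizeY ]′ (P +P Q)
  HasGF-⊎ gfX gfY n = ↔-trans (Fiber-⊎ n) (↔-trans (gfX n ⊎-↔ gfY n) (↔-sym Finₚ.+↔⊎))

  Fiber-× : ∀ n → Fiber (X × Y) (λ (x , y) → sizeX x + sizeY y) n ↔
                  Σ (Fin (suc n)) (λ k → Fiber X sizeX (toℕ k) × Fiber Y sizeY (n ∸ toℕ k))
  Fiber-× n = mk↔ₛ′ to′ from′ to∘from (λ _ → refl)
    where
    to′ : Fiber (X × Y) _ n → Σ (Fin (suc n)) (λ k → Fiber X sizeX (toℕ k) × Fiber Y sizeY (n ∸ toℕ k))
    to′ ((x , y) , [ p′ ]) = fromℕ< k<n , (x , [ sym k≡ ]) , (y , [ sizeY≡ ])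
      where
      p : sizeX x + sizeY y ≡ n
      p = ≡-recompute _≟_ p′
      k<n : sizeX x < suc n
      k<n = s≤s (subst (sizeX x ≤_) p (m≤m+n _ _))
      k≡ : toℕ (fromℕ< k<n) ≡ sizeX x
      k≡ = Finₚ.toℕ-fromℕ< k<n
      sizeY≡ : sizeY y ≡ n ∸ toℕ (fromℕ< k<n)
      sizeY≡ = trans (sym (m+n∸m≡n (sizeX x) (sizeY y))) (trans (cong (_∸ sizeX x) p) (cong (n ∸_) (sym k≡)))
    from′ : Σ (Fin (suc n)) (λ k → Fiber X sizeX (toℕ k) × Fiber Y sizeY (n ∸ toℕ k)) → Fiber (X × Y) _ n
    from′ (k , (x , [ p ]) , (y , [ q ])) = (x , y) , [ trans (cong₂ _+_ p q) (m+[n∸m]≡n (s≤s⁻¹ (Finₚ.toℕ<n k))) ]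
    pair-≡ : ∀ {k k′} x y (p : Irrelevant (sizeX x ≡ toℕ k′)) (q : Irrelevant (sizeY y ≡ n ∸ toℕ k′))
             (p′ : Irrelevant (sizeX x ≡ toℕ k)) (q′ : Irrelevant (sizeY y ≡ n ∸ toℕ k)) → k′ ≡ k →
             _≡_ {A = Σ (Fin (suc n)) (λ k → Fiber X sizeX (toℕ k) × Fiber Y sizeY (n ∸ toℕ k))}
                 (k′ , (x , p) , (y , q)) (k , (x , p′) , (y , q′))
    pair-≡ x y _ _ _ _ refl = refl
    to∘from : ∀ z → to′ (from′ z) ≡ z
    to∘from (k , (x , [ p ]) , (y , [ q ])) =
      pair-≡ x y _ _ _ _ (Finₚ.toℕ-injective (trans (Finₚ.toℕ-fromℕ< _) (≡-recompute _≟_ p)))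

  HasGF-× : {P Q : Poly} → HasGF X sizeX P → HasGF Y sizeY Q → HasGF (X × Y) (λ (x , y) → sizeX x + sizeY y) (P *P Q)
  HasGF-× {P} {Q} gfX gfY n =
    ↔-trans (Fiber-× n)
   (↔-trans (Σ-↔ ↔-refl (λ {k} → ↔-trans (gfX (toℕ k) ×-↔ gfY (n ∸ toℕ k)) (↔-sym Finₚ.*↔×)))
   (↔-sym (↔-trans (Fin-cong (cong sum (map-upTo _ (suc n)))) (Fin-sum-applyUpTo (λ k → P k * Q (n ∸ k)) (suc n)))))

HasGF-cong : {X : Set} {size : X → ℕ} {P Q : Poly} → (∀ n → P n ≡ Q n) → HasGF X size P → HasGF X size Q
HasGF-cong P≗Q gf n = ↔-trans (gf n) (Fin-cong (P≗Q n))

Σ-restrict : ∀ {X Y : Set} (f : X ↔ Y) (Q : Y → Set) →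
             Σ X (λ x → Irrelevant (Q (Inverse.to f x))) ↔ Σ Y (λ y → Irrelevant (Q y))
Σ-restrict f Q = mk↔ₛ′ (λ (x , [ q ]) → to x , [ q ])
                      (λ (y , [ q ]) → from y , [ subst Q (sym (strictlyInverseˡ y)) q ])
                      (λ (y , _) → Σ-≡-irrelevant (strictlyInverseˡ y))
                      (λ (x , _) → Σ-≡-irrelevant (strictlyInverseʳ x))
  where open Inverse f

Σ-×↔Fiber : ∀ {X : Set} (size : X → ℕ) (Q : X → Set) n →
            Σ X (λ x → Irrelevant (size x ≡ n × Q x)) ↔ Fiber (Σ X (λ x → Irrelevant (Q x))) (size ∘ proj₁) n
Σ-×↔Fiber size Q n = mk↔ₛ′ (λ (x , [ p ]) → (x , [ proj₂ p ]) , [ proj₁ p ])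
                           (λ ((x , [ q ]) , [ p ]) → x , [ p , q ])
                           (λ _ → refl) (λ _ → refl)

↔-×-⊤ : {X : Set} → X ↔ (X × ⊤)
↔-×-⊤ = mk↔ₛ′ (_, tt) proj₁ (λ _ → refl) (λ _ → refl)

HasGF-⊤ : HasGF ⊤ (λ _ → 0) oneP
HasGF-⊤ zero    = mk↔ₛ′ (λ _ → fzero) (λ _ → tt , [ refl ]) (λ { fzero → refl ; (fsuc ()) }) (λ _ → refl)
HasGF-⊤ (suc n) = ¬⇒↔Fin (λ (_ , [ p ]) → ⊥-elim-irr (0≢1+n p)) refl

shiftP-< : ∀ e (P : Poly) {n} → n < e → shiftP e P n ≡ 0
shiftP-< e P {n} n<e with n <ᵇ e | <⇒<ᵇ n<e
... | true | _ = refl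

shiftP-≥ : ∀ e (P : Poly) {n} → e ≤ n → shiftP e P n ≡ P (n ∸ e)
shiftP-≥ e P {n} e≤n with n <ᵇ e in eq
... | false = refl
... | true  = ⊥-elim (<⇒≱ (<ᵇ⇒< n e (subst T (sym eq) tt)) e≤n)

HasGF-shift : {X : Set} {size : X → ℕ} {P : Poly} (e : ℕ) → HasGF X size P → HasGF X (λ x → e + size x) (shiftP e P)
HasGF-shift {X} {size} {P} e gf n with n <? e
... | yes n<e = ¬⇒↔Fin too-small (shiftP-< e P n<e)
  where
  too-small : ¬ Fiber X (λ x → e + size x) n
  too-small (x , [ p ]) = <⇒≱ n<e (subst (e ≤_) (≡-recompute _≟_ p) (m≤m+n e (size x)))
... | no n≮e = ↔-trans unshift (↔-trans (gf (n ∸ e)) (Fin-cong (sym (shiftP-≥ e P e≤n))))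
  where
  e≤n : e ≤ n
  e≤n = ≮⇒≥ n≮e
  unshift : Fiber X (λ x → e + size x) n ↔ Fiber X size (n ∸ e)
  unshift = mk↔ₛ′ (λ (x , [ p ]) → x , [ trans (sym (m+n∸m≡n e (size x))) (cong (_∸ e) p) ])
                  (λ (x , [ p ]) → x , [ trans (cong (e +_) p) (m+[n∸m]≡n e≤n) ])
                  (λ _ → refl) (λ _ → refl)

sum-applyUpTo-zero : ∀ (f : ℕ → ℕ) n → (∀ i → f i ≡ 0) → sum (applyUpTo f n) ≡ 0
sum-applyUpTo-zero f zero    f≗0 = refl
sum-applyUpTo-zero f (suc n) f≗0 = cong₂ _+_ (f≗0 0) (sum-applyUpTo-zero (f ∘ suc) n (f≗0 ∘ suc))

*P-cong : ∀ {f f′ g g′ : Poly} → (∀ k → f k ≡ f′ k) → (∀ k → g k ≡ g′ k) → ∀ n → (f *P g) n ≡ (f′ *P g′) n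
*P-cong f≗f′ g≗g′ n = cong sum (map-cong (λ k → cong₂ _*_ (f≗f′ k) (g≗g′ (n ∸ k))) (upTo (suc n)))

*P-zeroˡ : ∀ (f g : Poly) → (∀ k → f k ≡ 0) → ∀ n → (f *P g) n ≡ 0
*P-zeroˡ f g f≗0 n = trans (cong sum (map-upTo _ (suc n)))
  (sum-applyUpTo-zero _ (suc n) (λ k → cong (_* g (n ∸ k)) (f≗0 k)))

*P-zeroʳ : ∀ (f g : Poly) → (∀ k → g k ≡ 0) → ∀ n → (f *P g) n ≡ 0
*P-zeroʳ f g g≗0 n = trans (cong sum (map-upTo _ (suc n)))
  (sum-applyUpTo-zero _ (suc n) (λ k → trans (cong (f k *_) (g≗0 (n ∸ k))) (*-zeroʳ (f k))))

*P-identityˡ : ∀ (g : Poly) n → (oneP *P g) n ≡ g n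
*P-identityˡ g n = trans (cong₂ _+_ (+-identityʳ (g n))
  (trans (cong sum (map-applyUpTo suc _ n)) (sum-applyUpTo-zero _ n (λ _ → refl)))) (+-identityʳ (g n))

shiftP-cong : ∀ {e e′} {P Q : Poly} → e ≡ e′ → (∀ k → P k ≡ Q k) → ∀ n → shiftP e P n ≡ shiftP e′ Q n
shiftP-cong {e} refl P≗Q n with n <ᵇ e
... | true  = refl
... | false = P≗Q (n ∸ e)

shiftP-zero : ∀ e (P : Poly) → (∀ k → P k ≡ 0) → ∀ n → shiftP e P n ≡ 0
shiftP-zero e P P≗0 n with n <ᵇ e
... | true  = refl
... | false = P≗0 (n ∸ e)

prodP-drop-ones : ∀ (h : ℕ → Poly) m k → (∀ i → i < m → ∀ n → h i n ≡ oneP n) →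
                  ∀ n → prodP (applyUpTo h (m + k)) n ≡ prodP (applyUpTo (λ i → h (m + i)) k) n
prodP-drop-ones h zero    k ones n = refl
prodP-drop-ones h (suc m) k ones n =
  trans (*P-cong {g = rest} (ones 0 z<s) (λ _ → refl) n)
 (trans (*P-identityˡ rest n) (prodP-drop-ones (h ∘ suc) m k (λ i i<m → ones (suc i) (s≤s i<m)) n))
  where rest = prodP (applyUpTo (h ∘ suc) (m + k))

gauss-< : ∀ {m k} → m < k → ∀ n → gauss m k n ≡ 0
gauss-< {zero}  {suc k} m<k n = refl
gauss-< {suc m} {suc k} m<k n =
  cong₂ _+_ (gauss-< (s≤s⁻¹ m<k) n) (shiftP-zero (suc k) _ (gauss-< (m<n⇒m<1+n (s≤s⁻¹ m<k))) n)

-- Gaussian polynomials count partitions in a box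

Ascending Descending : List ℕ → Set
Ascending  = Linked _≤_
Descending = Linked _≥_

Box : ℕ → ℕ → Set
Box N r = Σ (List ℕ) (λ xs → Irrelevant (length xs ≡ r × Ascending xs × All (_≤ N) xs))

Box-size : {N r : ℕ} → Box N r → ℕ
Box-size = sum ∘ proj₁

sum-map-suc : ∀ xs → sum (map suc xs) ≡ length xs + sum xs
sum-map-suc []       = refl
sum-map-suc (x ∷ xs) = cong suc (trans (cong (x +_) (sum-map-suc xs)) (x∙yz≈y∙xz x (length xs) (sum xs)))

map-suc∘pred : ∀ {xs} → All (1 ≤_) xs → map suc (map pred xs) ≡ xs
map-suc∘pred []             = refl
map-suc∘pred (s≤s _ ∷ ones) = cong (_ ∷_) (map-suc∘pred ones)

map-pred∘suc : ∀ xs → map pred (map suc xs) ≡ xs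
map-pred∘suc []       = refl
map-pred∘suc (x ∷ xs) = cong (x ∷_) (map-pred∘suc xs)

Box-empty↔⊤ : ∀ N → Box N 0 ↔ ⊤
Box-empty↔⊤ N = mk↔ₛ′ (λ _ → tt) (λ _ → [] , [ refl , [] , [] ]) (λ _ → refl) from∘to
  where
  from∘to : ∀ (xs : Box N 0) → ([] , [ refl , [] , [] ]) ≡ xs
  from∘to ([]    , _)     = refl
  from∘to (_ ∷ _ , [ p ]) = ⊥-elim-irr (1+n≢0 (proj₁ p))

0∷-Ascending : ∀ {xs} → Ascending xs → Ascending (0 ∷ xs)
0∷-Ascending {[]}    _   = [-]
0∷-Ascending {_ ∷ _} asc = z≤n ∷ asc

Box-width0-suc↔ : ∀ r → Box 0 (suc r) ↔ Box 0 r
Box-width0-suc↔ r = mk↔ₛ′ to′ from′ (λ _ → refl) from∘to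
  where
  to′ : Box 0 (suc r) → Box 0 r
  to′ ([]     , [ p ]) = ⊥-elim-irr (0≢1+n (proj₁ p))
  to′ (_ ∷ xs , [ p ]) = xs , [ suc-injective (proj₁ p) , Linked.tail (proj₁ (proj₂ p)) , All.tail (proj₂ (proj₂ p)) ]
  from′ : Box 0 r → Box 0 (suc r)
  from′ (xs , [ p ]) = 0 ∷ xs , [ cong suc (proj₁ p) , 0∷-Ascending (proj₁ (proj₂ p)) , z≤n ∷ proj₂ (proj₂ p) ]
  from∘to : ∀ xs → from′ (to′ xs) ≡ xs
  from∘to ([]         , [ p ]) = ⊥-elim-irr (0≢1+n (proj₁ p))
  from∘to (zero ∷ _   , _)     = refl
  from∘to (suc _ ∷ _  , [ p ]) = ⊥-elim-irr (n≮0 (All.head (proj₂ (proj₂ p))))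

-- q-Pascal: either the smallest entry is 0 and is dropped, or all r+1 entries are
-- positive and 1 is subtracted from each.
Box-suc↔ : ∀ N r → Box (suc N) (suc r) ↔ (Box (suc N) r ⊎ Box N (suc r))
Box-suc↔ N r = mk↔ₛ′ to′ from′ to∘from from∘to
  where
  to′ : Box (suc N) (suc r) → Box (suc N) r ⊎ Box N (suc r)
  to′ ([]          , [ p ]) = ⊥-elim-irr (0≢1+n (proj₁ p))
  to′ (zero ∷ xs   , [ p ]) = inj₁ (xs , [ suc-injective (proj₁ p) , Linked.tail (proj₁ (proj₂ p)) , All.tail (proj₂ (proj₂ p)) ])
  to′ (suc x ∷ xs  , [ p ]) = inj₂ (map pred (suc x ∷ xs) ,
    [ trans (length-map pred (suc x ∷ xs)) (proj₁ p) , Linked.map⁺ (Linked.map pred-mono-≤ (proj₁ (proj₂ p))) ,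
      All.map⁺ (All.map pred-mono-≤ (proj₂ (proj₂ p))) ])
  from′ : Box (suc N) r ⊎ Box N (suc r) → Box (suc N) (suc r)
  from′ (inj₁ (xs , [ p ])) = 0 ∷ xs , [ cong suc (proj₁ p) , 0∷-Ascending (proj₁ (proj₂ p)) , z≤n ∷ proj₂ (proj₂ p) ]
  from′ (inj₂ (xs , [ p ])) = map suc xs ,
    [ trans (length-map suc xs) (proj₁ p) , Linked.map⁺ (Linked.map s≤s (proj₁ (proj₂ p))) , All.map⁺ (All.map s≤s (proj₂ (proj₂ p))) ]
  to∘from : ∀ y → to′ (from′ y) ≡ y
  to∘from (inj₁ _)              = refl
  to∘from (inj₂ ([]     , [ p ])) = ⊥-elim-irr (0≢1+n (proj₁ p))
  to∘from (inj₂ (x ∷ xs , _))   = cong inj₂ (Σ-≡-irrelevant (cong (x ∷_) (map-pred∘suc xs)))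
  from∘to : ∀ xs → from′ (to′ xs) ≡ xs
  from∘to ([]         , [ p ]) = ⊥-elim-irr (0≢1+n (proj₁ p))
  from∘to (zero ∷ _   , _)     = refl
  from∘to (suc x ∷ xs , [ p ]) = Σ-≡-irrelevant (≡-recompute (≡-dec _≟_) (map-suc∘pred (positive (proj₁ (proj₂ p)))))
    where
    positive : Ascending (suc x ∷ xs) → All (1 ≤_) (suc x ∷ xs)
    positive = Linked.Linked⇒All ≤-trans (s≤s z≤n)

Box-suc↔-size : ∀ N r (xs : Box (suc N) (suc r)) →
                [ Box-size , (λ ys → suc r + Box-size ys) ]′ (Inverse.to (Box-suc↔ N r) xs) ≡ Box-size xs
Box-suc↔-size N r ([]         , [ p ]) = ⊥-elim-irr (0≢1+n (proj₁ p))
Box-suc↔-size N r (zero ∷ _   , _)     = refl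
Box-suc↔-size N r (suc x ∷ xs , [ p ]) = ≡-recompute _≟_ (begin
  suc r + sum (map pred ys)              ≡⟨ cong (_+ sum (map pred ys)) (trans (sym (proj₁ p)) (sym (length-map pred ys))) ⟩
  length (map pred ys) + sum (map pred ys) ≡⟨ sym (sum-map-suc (map pred ys)) ⟩
  sum (map suc (map pred ys))            ≡⟨ cong sum (map-suc∘pred (Linked.Linked⇒All ≤-trans (s≤s z≤n) (proj₁ (proj₂ p)))) ⟩
  sum ys                                 ∎)
  where
  open ≡-Reasoning
  ys = suc x ∷ xs

gauss-counts-Box : ∀ N r → HasGF (Box N r) Box-size (gauss (N + r) r)
gauss-counts-Box N zero = HasGF-↔ (Box-empty↔⊤ N) empty-size HasGF-⊤
  where
  empty-size : ∀ (xs : Box N 0) → 0 ≡ Box-size xs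
  empty-size ([]    , _)     = refl
  empty-size (_ ∷ _ , [ p ]) = ⊥-elim-irr (1+n≢0 (proj₁ p))
gauss-counts-Box zero (suc r) =
  HasGF-cong (λ n → cong (gauss r r n +_) (sym (shiftP-zero (suc r) _ (gauss-< (n<1+n r)) n)))
    (HasGF-cong (λ n → sym (+-identityʳ _)) (HasGF-↔ (Box-width0-suc↔ r) size-to (gauss-counts-Box zero r)))
  where
  size-to : ∀ xs → Box-size (Inverse.to (Box-width0-suc↔ r) xs) ≡ Box-size xs
  size-to ([]        , [ p ]) = ⊥-elim-irr (0≢1+n (proj₁ p))
  size-to (zero ∷ _  , _)     = refl
  size-to (suc _ ∷ _ , [ p ]) = ⊥-elim-irr (n≮0 (All.head (proj₂ (proj₂ p))))
gauss-counts-Box (suc N) (suc r) =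
  HasGF-cong (λ n → cong (λ m → gauss m r n + shiftP (suc r) (gauss (N + suc r) (suc r)) n) (sym (+-suc N r)))
    (HasGF-↔ (Box-suc↔ N r) (Box-suc↔-size N r)
      (HasGF-⊎ (gauss-counts-Box (suc N) r) (HasGF-shift (suc r) (gauss-counts-Box N (suc r)))))

-- Balanced blocks and the row condition

!-++ˡ : ∀ (β μ : List ℕ) {i} → 1 ≤ i → i ≤ length β → (β ++ μ) ! i ≡ β ! i
!-++ˡ (x ∷ β) μ {suc zero}    _ _         = refl
!-++ˡ (x ∷ β) μ {suc (suc i)} _ (s≤s i≤β) = !-++ˡ β μ (s≤s z≤n) i≤β

!-++ʳ : ∀ (β μ : List ℕ) {k} → 1 ≤ k → (β ++ μ) ! (length β + k) ≡ μ ! k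
!-++ʳ []      μ         _ = refl
!-++ʳ (x ∷ β) μ {suc k} _ =
  trans (cong ((x ∷ β ++ μ) !_) (cong suc (+-suc (length β) k))) (trans (cong ((β ++ μ) !_) (sym (+-suc (length β) k))) (!-++ʳ β μ (s≤s z≤n)))

!-++ʳ-∸ : ∀ (β μ : List ℕ) {i} → length β < i → (β ++ μ) ! i ≡ μ ! (i ∸ length β)
!-++ʳ-∸ β μ {i} β<i = trans (cong ((β ++ μ) !_) (sym (m+[n∸m]≡n (<⇒≤ β<i)))) (!-++ʳ β μ (m<n⇒0<n∸m β<i))

replicate-! : ∀ n {x i : ℕ} → 1 ≤ i → i ≤ n → replicate n x ! i ≡ x
replicate-! (suc n) {i = suc zero}    _ _         = refl
replicate-! (suc n) {i = suc (suc i)} _ (s≤s i≤n) = replicate-! n (s≤s z≤n) i≤n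

replicate-++-!ˡ : ∀ n {x : ℕ} ys {i} → 1 ≤ i → i ≤ n → (replicate n x ++ ys) ! i ≡ x
replicate-++-!ˡ n ys 1≤i i≤n =
  trans (!-++ˡ (replicate n _) ys 1≤i (subst (_ ≤_) (sym (length-replicate n)) i≤n)) (replicate-! n 1≤i i≤n)

replicate-++-!ʳ : ∀ n m {x y i : ℕ} → n < i → i ≤ n + m → (replicate n x ++ replicate m y) ! i ≡ y
replicate-++-!ʳ n m {x} {y} {i} n<i i≤n+m = begin
  (replicate n x ++ replicate m y) ! i ≡⟨ !-++ʳ-∸ (replicate n x) _ (subst (_< i) (sym (length-replicate n)) n<i) ⟩
  replicate m y ! (i ∸ length (replicate n x)) ≡⟨ cong (λ l → replicate m y ! (i ∸ l)) (length-replicate n) ⟩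
  replicate m y ! (i ∸ n)                      ≡⟨ replicate-! m (m<n⇒0<n∸m n<i) (m≤n+o⇒m∸n≤o i n i≤n+m) ⟩
  y                                            ∎
  where open ≡-Reasoning

Descending-++ : ∀ (xs ys : List ℕ) → Descending xs → Descending ys →
                (1 ≤ length xs → 1 ≤ length ys → ys ! 1 ≤ xs ! length xs) → Descending (xs ++ ys)
Descending-++ []               ys _              dys _    = dys
Descending-++ (x ∷ [])         []       _        _   _    = [-]
Descending-++ (x ∷ [])         (y ∷ ys) _        dys join = join (s≤s z≤n) (s≤s z≤n) ∷ dys
Descending-++ (x ∷ x′ ∷ xs)    ys       (r ∷ dxs) dys join =
  r ∷ Descending-++ (x′ ∷ xs) ys dxs dys (λ _ → join (s≤s z≤n))

Descending-++⁻ : ∀ (xs ys : List ℕ) → Descending (xs ++ ys) → Descending xs × Descending ys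
Descending-++⁻ []            ys d       = [] , d
Descending-++⁻ (x ∷ [])      []       _ = [-] , []
Descending-++⁻ (x ∷ [])      (y ∷ ys) (_ ∷ d) = [-] , d
Descending-++⁻ (x ∷ x′ ∷ xs) ys       (r ∷ d) = Product.map₁ (r ∷_) (Descending-++⁻ (x′ ∷ xs) ys d)

replicate-Descending : ∀ n {x : ℕ} → Descending (replicate n x)
replicate-Descending zero          = []
replicate-Descending (suc zero)    = [-]
replicate-Descending (suc (suc n)) = ≤-refl ∷ replicate-Descending (suc n)

∷-Descending : ∀ {x xs} → All (_≤ x) xs → Descending xs → Descending (x ∷ xs)
∷-Descending {xs = []}    _           _ = [-]
∷-Descending {xs = _ ∷ _} (y≤x ∷ _) d = y≤x ∷ d

Descending⇒≤head : ∀ {x xs} → Descending (x ∷ xs) → All (_≤ x) xs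
Descending⇒≤head d = All.tail (Linked.Linked⇒All (λ y≤x z≤y → ≤-trans z≤y y≤x) ≤-refl d)

sum-replicate : ∀ n (x : ℕ) → sum (replicate n x) ≡ n * x
sum-replicate zero    x = refl
sum-replicate (suc n) x = cong (x +_) (sum-replicate n x)

flatBlock : ℕ → ℕ → ℕ → List ℕ
flatBlock v j L = replicate j (suc v) ++ replicate (L ∸ j) v

module _ {v j L : ℕ} where

  length-flatBlock : j ≤ L → length (flatBlock v j L) ≡ L
  length-flatBlock j≤L = begin
    length (flatBlock v j L)                                ≡⟨ length-++ (replicate j (suc v)) ⟩
    length (replicate j (suc v)) + length (replicate (L ∸ j) v) ≡⟨ cong₂ _+_ (length-replicate j) (length-replicate (L ∸ j)) ⟩
    j + (L ∸ j)                                             ≡⟨ m+[n∸m]≡n j≤L ⟩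
    L                                                       ∎
    where open ≡-Reasoning

  sum-flatBlock : j ≤ L → sum (flatBlock v j L) ≡ j + v * L
  sum-flatBlock j≤L = begin
    sum (flatBlock v j L)                  ≡⟨ sum-++ (replicate j (suc v)) _ ⟩
    sum (replicate j (suc v)) + sum (replicate (L ∸ j) v) ≡⟨ cong₂ _+_ (sum-replicate j (suc v)) (sum-replicate (L ∸ j) v) ⟩
    j * suc v + (L ∸ j) * v              ≡⟨ regroup j v (L ∸ j) ⟩
    j + (j + (L ∸ j)) * v                ≡⟨ cong (λ l → j + l * v) (m+[n∸m]≡n j≤L) ⟩
    j + L * v                            ≡⟨ cong (j +_) (*-comm L v) ⟩
    j + v * L                            ∎
    where
    open ≡-Reasoning
    regroup : ∀ j v k → j * suc v + k * v ≡ j + (j + k) * v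
    regroup = solve-∀

  flatBlock-!-high : ∀ {i} → 1 ≤ i → i ≤ j → flatBlock v j L ! i ≡ suc v
  flatBlock-!-high = replicate-++-!ˡ j (replicate (L ∸ j) v)

  flatBlock-!-low : ∀ {i} → j ≤ L → j < i → i ≤ L → flatBlock v j L ! i ≡ v
  flatBlock-!-low j≤L j<i i≤L = replicate-++-!ʳ j (L ∸ j) j<i (subst (_ ≤_) (sym (m+[n∸m]≡n j≤L)) i≤L)

  flatBlock-!-≤ : ∀ {i} → j ≤ L → 1 ≤ i → i ≤ L → flatBlock v j L ! i ≤ suc v
  flatBlock-!-≤ {i} j≤L 1≤i i≤L with i ≤? j
  ... | yes i≤j = ≤-reflexive (flatBlock-!-high 1≤i i≤j)
  ... | no  i≰j = ≤-trans (≤-reflexive (flatBlock-!-low j≤L (≰⇒> i≰j) i≤L)) (n≤1+n v)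

  flatBlock-!-≥ : ∀ {i} → j ≤ L → 1 ≤ i → i ≤ L → v ≤ flatBlock v j L ! i
  flatBlock-!-≥ {i} j≤L 1≤i i≤L with i ≤? j
  ... | yes i≤j = ≤-trans (n≤1+n v) (≤-reflexive (sym (flatBlock-!-high 1≤i i≤j)))
  ... | no  i≰j = ≤-reflexive (sym (flatBlock-!-low j≤L (≰⇒> i≰j) i≤L))

  flatBlock-Descending : Descending (flatBlock v j L)
  flatBlock-Descending = Descending-++ (replicate j (suc v)) _ (replicate-Descending j) (replicate-Descending (L ∸ j)) join
    where
    join : 1 ≤ length (replicate j (suc v)) → 1 ≤ length (replicate (L ∸ j) v) →
           replicate (L ∸ j) v ! 1 ≤ replicate j (suc v) ! length (replicate j (suc v))
    join 1≤j 1≤L∸j = ≤-trans (≤-reflexive (replicate-! (L ∸ j) ≤-refl (subst (1 ≤_) (length-replicate (L ∸ j)) 1≤L∸j)))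
      (≤-trans (n≤1+n v) (≤-reflexive (sym (trans (cong (replicate j (suc v) !_) (length-replicate j))
                                                    (replicate-! j (subst (1 ≤_) (length-replicate j) 1≤j) ≤-refl)))))

NearlyFlat : ℕ → List ℕ → Set
NearlyFlat L β = β ! 1 ≤ β ! L + 1

Descending-NearlyFlat⇒flatBlock : ∀ k β → length β ≡ suc k → Descending β → NearlyFlat (suc k) β →
                                  Σ ℕ λ v → Σ ℕ λ j → j < suc k × β ≡ flatBlock v j (suc k)
Descending-NearlyFlat⇒flatBlock zero (x ∷ []) _ _ _ = x , 0 , z<s , refl
Descending-NearlyFlat⇒flatBlock (suc k) (x ∷ y ∷ β) len (y≤x ∷ desc) flat
  with Descending-NearlyFlat⇒flatBlock k (y ∷ β) (suc-injective len) desc (≤-trans y≤x flat)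
... | v , j , j<k , tail≡ = extend j j<k tail≡
  where
  x≤v+1 : ∀ {j} → j < suc k → y ∷ β ≡ flatBlock v j (suc k) → x ≤ suc v
  x≤v+1 j<k tail≡ = subst (x ≤_) (trans (cong (λ xs → xs ! suc k + 1) tail≡)
    (trans (cong (_+ 1) (flatBlock-!-low (<⇒≤ j<k) j<k ≤-refl)) (+-comm v 1))) flat
  extend : ∀ j → j < suc k → y ∷ β ≡ flatBlock v j (suc k) →
           Σ ℕ λ v → Σ ℕ λ j → j < suc (suc k) × x ∷ y ∷ β ≡ flatBlock v j (suc (suc k))
  extend zero j<k tail≡ with x ≟ v
  ... | yes x≡v = v , 0 , z<s , cong₂ _∷_ x≡v tail≡
  ... | no  x≢v = v , 1 , s≤s z<s , cong₂ _∷_ x≡v+1 tail≡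
    where
    v≤x : v ≤ x
    v≤x = subst (_≤ x) (trans (cong (_! 1) tail≡) (flatBlock-!-low {v} {0} {suc k} z≤n z<s (s≤s z≤n))) y≤x
    x≡v+1 : x ≡ suc v
    x≡v+1 with m≤n⇒m<n∨m≡n (x≤v+1 j<k tail≡)
    ... | inj₂ x≡v+1 = x≡v+1
    ... | inj₁ x<v+1 = ⊥-elim (x≢v (≤-antisym (s≤s⁻¹ x<v+1) v≤x))
  extend (suc j) j<k tail≡ = v , suc (suc j) , s≤s j<k , cong₂ _∷_ x≡v+1 tail≡
    where
    x≡v+1 : x ≡ suc v
    x≡v+1 = ≤-antisym (x≤v+1 j<k tail≡)
      (subst (_≤ x) (trans (cong (_! 1) tail≡) (flatBlock-!-high {v} {suc j} {suc k} (s≤s z≤n) (s≤s z≤n))) y≤x)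

balanced : (L : ℕ) .{{_ : NonZero L}} → ℕ → List ℕ
balanced L S = flatBlock (S / L) (S % L) L

module _ (L : ℕ) .{{_ : NonZero L}} where

  private
    %<L : ∀ S → S % L ≤ L
    %<L S = <⇒≤ (m%n<n S L)

  length-balanced : ∀ S → length (balanced L S) ≡ L
  length-balanced S = length-flatBlock (%<L S)

  sum-balanced : ∀ S → sum (balanced L S) ≡ S
  sum-balanced S = trans (sum-flatBlock (%<L S)) (sym (m≡m%n+[m/n]*n S L))

  flatBlock≡balanced : ∀ {v j} → j < L → flatBlock v j L ≡ balanced L (j + v * L)
  flatBlock≡balanced {v} {j} j<L = sym (cong₂ (λ v′ j′ → flatBlock v′ j′ L) quotient remainder)
    where
    remainder : (j + v * L) % L ≡ j
    remainder = trans ([m+kn]%n≡m%n j v L) (m<n⇒m%n≡m j<L)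
    quotient : (j + v * L) / L ≡ v
    quotient = sym (*-cancelʳ-≡ v _ L (+-cancelˡ-≡ j _ _
      (trans (m≡m%n+[m/n]*n (j + v * L) L) (cong (_+ (j + v * L) / L * L) remainder))))

  balanced-!-≤ : ∀ S {i} → 1 ≤ i → i ≤ L → balanced L S ! i ≤ suc (S / L)
  balanced-!-≤ S = flatBlock-!-≤ (%<L S)

  balanced-!-≥ : ∀ S {i} → 1 ≤ i → i ≤ L → S / L ≤ balanced L S ! i
  balanced-!-≥ S = flatBlock-!-≥ (%<L S)

  balanced-!-last : ∀ S → balanced L S ! L ≡ S / L
  balanced-!-last S = flatBlock-!-low (%<L S) (m%n<n S L) ≤-refl

  balanced-Descending : ∀ S → Descending (balanced L S)
  balanced-Descending S = flatBlock-Descending {S / L} {S % L} {L}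

  balanced-NearlyFlat : ∀ S → NearlyFlat L (balanced L S)
  balanced-NearlyFlat S = subst (balanced L S ! 1 ≤_) (trans (+-comm 1 _) (cong (_+ 1) (sym (balanced-!-last S))))
    (balanced-!-≤ S ≤-refl (>-nonZero⁻¹ L))

  balanced-≤ : ∀ {a S} → S ≤ a * L → All (_≤ a) (balanced L S)
  balanced-≤ {a} {S} S≤aL = All.++⁺ (replicate-≤ j high≤a) (replicate-≤ (L ∸ j) (λ _ → v≤a))
    where
    v = S / L
    j = S % L
    replicate-≤ : ∀ n {x} → (1 ≤ n → x ≤ a) → All (_≤ a) (replicate n x)
    replicate-≤ zero    _   = []
    replicate-≤ (suc n) x≤a = All.replicate⁺ (suc n) (x≤a (s≤s z≤n))
    v≤a : v ≤ a
    v≤a = *-cancelʳ-≤ v a L (≤-trans (m≤n+m (v * L) j) (≤-trans (≤-reflexive (sym (m≡m%n+[m/n]*n S L))) S≤aL))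
    high≤a : 1 ≤ j → suc v ≤ a
    high≤a 1≤j with suc v ≤? a
    ... | yes v<a = v<a
    ... | no  v≮a = ⊥-elim (<⇒≱ aL<S S≤aL)
      where
      aL<S : a * L < S
      aL<S = begin-strict
        a * L     ≤⟨ *-monoˡ-≤ L (s≤s⁻¹ (≰⇒> v≮a)) ⟩
        v * L     <⟨ +-monoˡ-≤ (v * L) 1≤j ⟩
        j + v * L ≡⟨ sym (m≡m%n+[m/n]*n S L) ⟩
        S         ∎
        where open ≤-Reasoning

  /-gap : ∀ {D S S′} → S′ + D * L ≤ S → S′ / L + D ≤ S / L
  /-gap {D} {S} {S′} gap with S′ / L + D ≤? S / L
  ... | yes ok = ok
  ... | no  ¬ok = ⊥-elim (<⇒≱ S<S′+DL gap)
    where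
    S<S′+DL : S < S′ + D * L
    S<S′+DL = begin-strict
      S                           ≡⟨ m≡m%n+[m/n]*n S L ⟩
      S % L + S / L * L           <⟨ +-monoˡ-< (S / L * L) (m%n<n S L) ⟩
      suc (S / L) * L             ≤⟨ *-monoˡ-≤ L (≰⇒> ¬ok) ⟩
      (S′ / L + D) * L            ≡⟨ *-distribʳ-+ L (S′ / L) D ⟩
      S′ / L * L + D * L          ≤⟨ +-monoˡ-≤ (D * L) (m≤n+m (S′ / L * L) (S′ % L)) ⟩
      S′ % L + S′ / L * L + D * L ≡⟨ cong (_+ D * L) (sym (m≡m%n+[m/n]*n S′ L)) ⟩
      S′ + D * L                  ∎
      where open ≤-Reasoning

  balanced-separated : ∀ {D S S′} → S′ + D * L ≤ S → ∀ {i} → 1 ≤ i → i ≤ L →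
                       balanced L S′ ! i + D ≤ balanced L S ! i
  balanced-separated {D} {S} {S′} gap {i} 1≤i i≤L with m≤n⇒m<n∨m≡n (/-gap {D} gap)
  ... | inj₁ lt = ≤-trans (+-monoˡ-≤ D (balanced-!-≤ S′ 1≤i i≤L)) (≤-trans lt (balanced-!-≥ S 1≤i i≤L))
  ... | inj₂ eq with i ≤? S′ % L
  ...   | yes i≤j′ = ≤-reflexive (trans (cong (_+ D) (flatBlock-!-high 1≤i i≤j′))
                       (trans (cong suc eq) (sym (flatBlock-!-high 1≤i (≤-trans i≤j′ j′≤j)))))
    where
    -- equal quotients force the remainders to be ordered like the sums
    j′≤j : S′ % L ≤ S % L
    j′≤j = +-cancelʳ-≤ (S / L * L) (S′ % L) (S % L) (begin
      S′ % L + S / L * L              ≡⟨ cong (λ q → S′ % L + q * L) (sym eq) ⟩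
      S′ % L + (S′ / L + D) * L       ≡⟨ regroup (S′ % L) (S′ / L) D L ⟩
      S′ % L + S′ / L * L + D * L     ≡⟨ cong (_+ D * L) (sym (m≡m%n+[m/n]*n S′ L)) ⟩
      S′ + D * L                      ≤⟨ gap ⟩
      S                               ≡⟨ m≡m%n+[m/n]*n S L ⟩
      S % L + S / L * L               ∎)
      where
      open ≤-Reasoning
      regroup : ∀ j q d l → j + (q + d) * l ≡ j + q * l + d * l
      regroup = solve-∀
  ...   | no  i≰j′ = ≤-trans (≤-reflexive (trans (cong (_+ D) (flatBlock-!-low (%<L S′) (≰⇒> i≰j′) i≤L)) eq))
                       (balanced-!-≥ S 1≤i i≤L)

NearlyFlat⇒≡balanced : ∀ L .{{_ : NonZero L}} β → length β ≡ L → Descending β → NearlyFlat L β →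
                       β ≡ balanced L (sum β)
NearlyFlat⇒≡balanced (suc k) β len desc flat with Descending-NearlyFlat⇒flatBlock k β len desc flat
... | v , j , j<L , β≡ = begin
  β                               ≡⟨ β≡ ⟩
  flatBlock v j (suc k)           ≡⟨ flatBlock≡balanced (suc k) j<L ⟩
  balanced (suc k) (j + v * suc k) ≡⟨ cong (balanced (suc k)) (sym (trans (cong sum β≡) (sum-flatBlock (<⇒≤ j<L)))) ⟩
  balanced (suc k) (sum β)        ∎
  where open ≡-Reasoning

All≤⇒sum≤length* : ∀ {a} xs → All (_≤ a) xs → sum xs ≤ length xs * a
All≤⇒sum≤length* []       []           = z≤n
All≤⇒sum≤length* (x ∷ xs) (x≤a ∷ xs≤a) = +-mono-≤ x≤a (All≤⇒sum≤length* xs xs≤a)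

pointwise-gap⇒sum-gap : ∀ D (xs ys : List ℕ) → length ys ≡ length xs →
                (∀ {i} → 1 ≤ i → i ≤ length xs → ys ! i + D ≤ xs ! i) → sum ys + length xs * D ≤ sum xs
pointwise-gap⇒sum-gap D []       []       _   _         = z≤n
pointwise-gap⇒sum-gap D (x ∷ xs) (y ∷ ys) len pointwise =
  subst (_≤ x + sum xs) (interchange y D (sum ys) (length xs * D))
    (+-mono-≤ (pointwise ≤-refl (s≤s z≤n))
              (pointwise-gap⇒sum-gap D xs ys (suc-injective len) (λ { {suc i} _ i≤ → pointwise (s≤s z≤n) (s≤s i≤) })))

m+n≤n*o⇒m≤n*[o∸1] : ∀ m n o → m + n ≤ n * o → m ≤ n * (o ∸ 1)
m+n≤n*o⇒m≤n*[o∸1] m n zero    m+n≤0  = ≤-trans (m≤m+n m n) m+n≤0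
m+n≤n*o⇒m≤n*[o∸1] m n (suc o) m+n≤no = +-cancelʳ-≤ n m (n * o) (subst (m + n ≤_) (trans (*-suc n o) (+-comm n (n * o))) m+n≤no)

m≤n*[o∸1]⇒m+n≤n*o : ∀ m n o → 1 ≤ m → m ≤ n * (o ∸ 1) → m + n ≤ n * o
m≤n*[o∸1]⇒m+n≤n*o m n zero    1≤m m≤0   = ⊥-elim (<⇒≱ 1≤m (subst (m ≤_) (*-zeroʳ n) m≤0))
m≤n*[o∸1]⇒m+n≤n*o m n (suc o) _   m≤n*o = subst (m + n ≤_) (trans (+-comm (n * o) n) (sym (*-suc n o))) (+-monoˡ-≤ n m≤n*o)

-- The guard 1 ≤ r matters: for r = 0 the list μ is empty and μ ! i is the junk value 0.
Separated : ℕ → ℕ → ℕ → List ℕ → List ℕ → Set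
Separated r L D β μ = 1 ≤ r → ∀ {i} → 1 ≤ i → i ≤ L → μ ! i + D ≤ β ! i

module _ (β μ : List ℕ) where

  private
    L = length β

    !-++-shift : ∀ {k} → 1 ≤ k → (β ++ μ) ! (k + L) ≡ μ ! k
    !-++-shift {k} 1≤k = trans (cong ((β ++ μ) !_) (+-comm k L)) (!-++ʳ β μ 1≤k)

    !-++-block-start : ∀ i → (β ++ μ) ! (suc i * L + 1) ≡ μ ! (i * L + 1)
    !-++-block-start i = trans (cong ((β ++ μ) !_) (+-assoc L (i * L) 1)) (!-++ʳ β μ (m≤n+m 1 (i * L)))

    !-++-block-end : ∀ i → 1 ≤ L → (β ++ μ) ! (L * (suc i + 1)) ≡ μ ! (L * (i + 1))
    !-++-block-end i 1≤L = trans (cong ((β ++ μ) !_) (*-suc L (i + 1)))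
      (!-++ʳ β μ (≤-trans 1≤L (m≤m*n L (i + 1) {{>-nonZero (m≤n+m 1 i)}})))

    positive : ∀ r {i} → 1 ≤ i → i ≤ L * r → 1 ≤ r
    positive zero    {i} 1≤i i≤L0 = ⊥-elim (<⇒≱ 1≤i (subst (i ≤_) (*-zeroʳ L) i≤L0))
    positive (suc r) _   _    = s≤s z≤n

    !-++-first : 1 ≤ L → (β ++ μ) ! 1 ≡ β ! 1
    !-++-first 1≤L = !-++ˡ β μ ≤-refl 1≤L

    !-++-last : 1 ≤ L → (β ++ μ) ! (L * (0 + 1)) ≡ β ! L
    !-++-last 1≤L = trans (cong ((β ++ μ) !_) (*-identityʳ L)) (!-++ˡ β μ 1≤L ≤-refl)

  RowCondition-++⁻ : ∀ {r D L′} → length β ≡ L′ → 1 ≤ L′ → RowCondition (suc r) L′ D (β ++ μ) →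
                     RowCondition r L′ D μ × NearlyFlat L′ β × Separated r L′ D β μ
  RowCondition-++⁻ {r} {D} refl 1≤L (len , flat , gap) = (lenμ , flatμ , gapμ) , flatβ , sep
    where
    lenμ : length μ ≡ r * L
    lenμ = +-cancelˡ-≡ L _ _ (trans (sym (length-++ β)) len)
    flatμ : ∀ i → i < r → μ ! (i * L + 1) ≤ μ ! (L * (i + 1)) + 1
    flatμ i i<r = subst₂ (λ u w → u ≤ w + 1) (!-++-block-start i) (!-++-block-end i 1≤L) (flat (suc i) (s≤s i<r))
    gapμ : ∀ i → 1 ≤ i → i ≤ L * (r ∸ 1) → μ ! (i + L) + D ≤ μ ! i
    gapμ i 1≤i i≤ = subst₂ (λ u w → u + D ≤ w) (!-++-shift (≤-trans 1≤i (m≤m+n i L))) (!-++-shift 1≤i)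
                      (gap (i + L) (≤-trans 1≤i (m≤m+n i L)) (m≤n*[o∸1]⇒m+n≤n*o i L r 1≤i i≤))
    flatβ : NearlyFlat L β
    flatβ = subst₂ (λ u w → u ≤ w + 1) (!-++-first 1≤L) (!-++-last 1≤L) (flat 0 z<s)
    sep : Separated r L D β μ
    sep 1≤r {i} 1≤i i≤L = subst₂ (λ u w → u + D ≤ w) (!-++-shift 1≤i) (!-++ˡ β μ 1≤i i≤L)
      (gap i 1≤i (≤-trans i≤L (m≤m*n L r {{>-nonZero 1≤r}})))

  RowCondition-++⁺ : ∀ {r D L′} → length β ≡ L′ → 1 ≤ L′ → RowCondition r L′ D μ → NearlyFlat L′ β →
                     Separated r L′ D β μ → RowCondition (suc r) L′ D (β ++ μ)
  RowCondition-++⁺ {r} {D} refl 1≤L (lenμ , flatμ , gapμ) flatβ sep = length≡ , flat , gap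
    where
    length≡ : length (β ++ μ) ≡ suc r * L
    length≡ = trans (length-++ β) (cong (L +_) lenμ)
    flat : ∀ i → i < suc r → (β ++ μ) ! (i * L + 1) ≤ (β ++ μ) ! (L * (i + 1)) + 1
    flat zero    _     = subst₂ (λ u w → u ≤ w + 1) (sym (!-++-first 1≤L)) (sym (!-++-last 1≤L)) flatβ
    flat (suc i) i<1+r = subst₂ (λ u w → u ≤ w + 1) (sym (!-++-block-start i)) (sym (!-++-block-end i 1≤L))
                           (flatμ i (s≤s⁻¹ i<1+r))
    gap : ∀ i → 1 ≤ i → i ≤ L * r → (β ++ μ) ! (i + L) + D ≤ (β ++ μ) ! i
    gap i 1≤i i≤Lr with i ≤? L
    ... | yes i≤L = subst₂ (λ u w → u + D ≤ w) (sym (!-++-shift 1≤i)) (sym (!-++ˡ β μ 1≤i i≤L))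
                      (sep (positive r 1≤i i≤Lr) 1≤i i≤L)
    ... | no  i≰L = subst₂ (λ u w → u + D ≤ w) (sym (trans (cong (λ x → (β ++ μ) ! (x + L)) (sym i≡)) (!-++-shift (≤-trans 1≤k (m≤m+n k L)))))
                      (sym (trans (cong ((β ++ μ) !_) (sym i≡)) (!-++-shift 1≤k)))
                      (gapμ k 1≤k k≤)
      where
      k = i ∸ L
      i≡ : k + L ≡ i
      i≡ = m∸n+n≡m (<⇒≤ (≰⇒> i≰L))
      1≤k : 1 ≤ k
      1≤k = m<n⇒0<n∸m (≰⇒> i≰L)
      k≤ : k ≤ L * (r ∸ 1)
      k≤ = m+n≤n*o⇒m≤n*[o∸1] k L r (subst (_≤ L * r) (sym i≡) i≤Lr)

take-length-++ : ∀ (xs ys : List ℕ) → take (length xs) (xs ++ ys) ≡ xs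
take-length-++ []       ys = refl
take-length-++ (x ∷ xs) ys = cong (x ∷_) (take-length-++ xs ys)

drop-length-++ : ∀ (xs ys : List ℕ) → drop (length xs) (xs ++ ys) ≡ ys
drop-length-++ []       ys = refl
drop-length-++ (x ∷ xs) ys = drop-length-++ xs ys

length-take-≤ : ∀ n (xs : List ℕ) → n ≤ length xs → length (take n xs) ≡ n
length-take-≤ n xs n≤xs = trans (length-take n xs) (m≤n⇒m⊓n≡m n≤xs)

module Blocks (L D a : ℕ) .{{_ : NonZero L}} where

  ValidRows : ℕ → List ℕ → Set
  ValidRows r μ = Descending μ × All (_≤ a) μ × RowCondition r L D μ

  SumsGap : List ℕ → Set
  SumsGap = Linked (λ S S′ → S′ + D * L ≤ S)

  ValidSums : ℕ → List ℕ → Set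
  ValidSums r Ss = length Ss ≡ r × SumsGap Ss × All (_≤ a * L) Ss

  blockSums : ℕ → List ℕ → List ℕ
  blockSums zero    μ = []
  blockSums (suc r) μ = sum (take L μ) ∷ blockSums r (drop L μ)

  fromBlockSums : List ℕ → List ℕ
  fromBlockSums []       = []
  fromBlockSums (S ∷ Ss) = balanced L S ++ fromBlockSums Ss

  record FirstBlock (r : ℕ) (μ : List ℕ) : Set where
    field
      length-first : length (take L μ) ≡ L
      desc-first   : Descending (take L μ)
      flat-first   : NearlyFlat L (take L μ)
      bound-first  : All (_≤ a) (take L μ)
      separated    : Separated r L D (take L μ) (drop L μ)
      valid-rest   : ValidRows r (drop L μ)

  firstBlock : ∀ r μ → ValidRows (suc r) μ → FirstBlock r μ
  firstBlock r μ (desc , bound , rc) = record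
    { length-first = length-first ; desc-first = proj₁ descs ; flat-first = proj₁ (proj₂ split)
    ; bound-first = proj₁ bounds ; separated = proj₂ (proj₂ split) ; valid-rest = proj₂ descs , proj₂ bounds , proj₁ split }
    where
    μ≡ : take L μ ++ drop L μ ≡ μ
    μ≡ = take++drop≡id L μ
    length-first : length (take L μ) ≡ L
    length-first = length-take-≤ L μ (subst (L ≤_) (sym (proj₁ rc)) (m≤m+n L (r * L)))
    split = RowCondition-++⁻ (take L μ) (drop L μ) length-first (>-nonZero⁻¹ L)
              (subst (RowCondition (suc r) L D) (sym μ≡) rc)
    descs = Descending-++⁻ (take L μ) (drop L μ) (subst Descending (sym μ≡) desc)
    bounds = All.++⁻ (take L μ) (subst (All (_≤ a)) (sym μ≡) bound)

  blockSums-valid : ∀ r μ → ValidRows r μ → ValidSums r (blockSums r μ)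
  blockSums-valid zero    μ _     = refl , [] , []
  blockSums-valid (suc r) μ valid =
    cong suc (proj₁ ih) , link r refl (proj₁ (proj₂ ih)) , first≤aL ∷ proj₂ (proj₂ ih)
    where
    open FirstBlock (firstBlock r μ valid)
    ih = blockSums-valid r (drop L μ) valid-rest
    first≤aL : sum (take L μ) ≤ a * L
    first≤aL = subst (sum (take L μ) ≤_) (trans (cong (_* a) length-first) (*-comm L a)) (All≤⇒sum≤length* (take L μ) bound-first)
    gap : 1 ≤ r → sum (take L (drop L μ)) + D * L ≤ sum (take L μ)
    gap 1≤r = subst (λ x → sum (take L (drop L μ)) + x ≤ sum (take L μ)) (trans (cong (_* D) length-first) (*-comm L D))
      (pointwise-gap⇒sum-gap D (take L μ) (take L (drop L μ)) same-length pointwise)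
      where
      same-length : length (take L (drop L μ)) ≡ length (take L μ)
      same-length = trans (length-take-≤ L (drop L μ)
        (subst (L ≤_) (sym (proj₁ (proj₂ (proj₂ valid-rest)))) (m≤n*m L r {{>-nonZero 1≤r}}))) (sym length-first)
      pointwise : ∀ {i} → 1 ≤ i → i ≤ length (take L μ) → take L (drop L μ) ! i + D ≤ take L μ ! i
      pointwise {i} 1≤i i≤ = subst (λ x → x + D ≤ take L μ ! i)
        (trans (cong (_! i) (sym (take++drop≡id L (drop L μ))))
               (!-++ˡ (take L (drop L μ)) _ 1≤i (subst (i ≤_) (sym same-length) i≤)))
        (separated 1≤r 1≤i (subst (i ≤_) length-first i≤))
    link : ∀ r′ → r ≡ r′ → SumsGap (blockSums r′ (drop L μ)) → SumsGap (sum (take L μ) ∷ blockSums r′ (drop L μ))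
    link zero     _  _    = [-]
    link (suc r′) r≡ rest = gap (subst (1 ≤_) (sym r≡) (s≤s z≤n)) ∷ rest

  fromBlockSums-separated : ∀ {r S} Ss → SumsGap (S ∷ Ss) → length Ss ≡ r →
                            Separated r L D (balanced L S) (fromBlockSums Ss)
  fromBlockSums-separated []        _         Ss≡r 1≤r 1≤i i≤L = ⊥-elim (<⇒≱ 1≤r (≤-reflexive (sym Ss≡r)))
  fromBlockSums-separated (S′ ∷ Ss) (gap ∷ _) _    _   {i} 1≤i i≤L =
    subst (λ x → x + D ≤ _) (sym (!-++ˡ (balanced L S′) _ 1≤i (subst (i ≤_) (sym (length-balanced L S′)) i≤L)))
      (balanced-separated L gap 1≤i i≤L)

  fromBlockSums-join : ∀ {S} Ss → 1 ≤ D → SumsGap (S ∷ Ss) → 1 ≤ length (fromBlockSums Ss) →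
                       fromBlockSums Ss ! 1 ≤ balanced L S ! length (balanced L S)
  fromBlockSums-join []        _   _         ()
  fromBlockSums-join {S} (S′ ∷ Ss) 1≤D (gap ∷ _) _ = subst₂ _≤_
    (sym (!-++ˡ (balanced L S′) _ ≤-refl (subst (1 ≤_) (sym (length-balanced L S′)) (>-nonZero⁻¹ L))))
    (sym (trans (cong (balanced L S !_) (length-balanced L S)) (balanced-!-last L S)))
    (≤-trans (balanced-!-≤ L S′ ≤-refl (>-nonZero⁻¹ L))
             (≤-trans (subst (_≤ S′ / L + D) (+-comm (S′ / L) 1) (+-monoʳ-≤ (S′ / L) 1≤D)) (/-gap L gap)))

  fromBlockSums-valid : ∀ r Ss → 1 ≤ D → ValidSums r Ss → ValidRows r (fromBlockSums Ss)
  fromBlockSums-valid zero    []       _   _ = [] , [] , refl , (λ _ ()) , (λ i 1≤i i≤0 → ⊥-elim (<⇒≱ 1≤i (subst (i ≤_) (*-zeroʳ L) i≤0)))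
  fromBlockSums-valid (suc r) (S ∷ Ss) 1≤D (length≡ , gaps , S≤aL ∷ Ss≤aL) =
    Descending-++ (balanced L S) _ (balanced-Descending L S) (proj₁ ih) (λ _ → fromBlockSums-join Ss 1≤D gaps) ,
    All.++⁺ (balanced-≤ L S≤aL) (proj₁ (proj₂ ih)) ,
    RowCondition-++⁺ (balanced L S) _ (length-balanced L S) (>-nonZero⁻¹ L) (proj₂ (proj₂ ih))
      (balanced-NearlyFlat L S) (fromBlockSums-separated Ss gaps (suc-injective length≡))
    where
    ih = fromBlockSums-valid r Ss 1≤D (suc-injective length≡ , Linked.tail gaps , Ss≤aL)

  blockSums∘fromBlockSums : ∀ r Ss → length Ss ≡ r → blockSums r (fromBlockSums Ss) ≡ Ss
  blockSums∘fromBlockSums zero    []       _       = refl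
  blockSums∘fromBlockSums (suc r) (S ∷ Ss) length≡ =
    cong₂ _∷_ (trans (cong sum take-first) (sum-balanced L S))
              (trans (cong (blockSums r) drop-first) (blockSums∘fromBlockSums r Ss (suc-injective length≡)))
    where
    β = balanced L S
    take-first : take L (β ++ fromBlockSums Ss) ≡ β
    take-first = subst (λ n → take n (β ++ fromBlockSums Ss) ≡ β) (length-balanced L S) (take-length-++ β _)
    drop-first : drop L (β ++ fromBlockSums Ss) ≡ fromBlockSums Ss
    drop-first = subst (λ n → drop n (β ++ fromBlockSums Ss) ≡ fromBlockSums Ss) (length-balanced L S) (drop-length-++ β _)

  fromBlockSums∘blockSums : ∀ r μ → ValidRows r μ → fromBlockSums (blockSums r μ) ≡ μ
  fromBlockSums∘blockSums zero    []      _                  = refl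
  fromBlockSums∘blockSums (suc r) μ       valid              =
    trans (cong₂ _++_ (sym first≡) (fromBlockSums∘blockSums r (drop L μ) valid-rest)) (take++drop≡id L μ)
    where
    open FirstBlock (firstBlock r μ valid)
    first≡ : take L μ ≡ balanced L (sum (take L μ))
    first≡ = NearlyFlat⇒≡balanced L (take L μ) length-first desc-first flat-first

  sum-blockSums : ∀ r μ → length μ ≡ r * L → sum (blockSums r μ) ≡ sum μ
  sum-blockSums zero    []      _       = refl
  sum-blockSums (suc r) μ       length≡ =
    trans (cong (sum (take L μ) +_) (sum-blockSums r (drop L μ) rest-length))
          (trans (sym (sum-++ (take L μ) (drop L μ))) (cong sum (take++drop≡id L μ)))
    where
    rest-length : length (drop L μ) ≡ r * L
    rest-length = trans (length-drop L μ) (trans (cong (_∸ L) length≡) (m+n∸m≡n L (r * L)))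

  Rows Sums : ℕ → Set
  Rows r = Σ (List ℕ) (λ μ  → Irrelevant (ValidRows r μ))
  Sums r = Σ (List ℕ) (λ Ss → Irrelevant (ValidSums r Ss))

  Rows↔Sums : ∀ r → 1 ≤ D → Rows r ↔ Sums r
  Rows↔Sums r 1≤D = mk↔ₛ′
    (λ (μ , [ valid ]) → blockSums r μ , [ blockSums-valid r μ valid ])
    (λ (Ss , [ valid ]) → fromBlockSums Ss , [ fromBlockSums-valid r Ss 1≤D valid ])
    (λ (Ss , [ valid ]) → Σ-≡-irrelevant (blockSums∘fromBlockSums r Ss (≡-recompute _≟_ (proj₁ valid))))
    (λ (μ , [ valid ]) → Σ-≡-irrelevant (≡-recompute (≡-dec _≟_) (fromBlockSums∘blockSums r μ valid)))

  Rows↔Sums-size : ∀ r (1≤D : 1 ≤ D) (μ : Rows r) → sum (proj₁ (Inverse.to (Rows↔Sums r 1≤D) μ)) ≡ sum (proj₁ μ)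
  Rows↔Sums-size r 1≤D (μ , [ valid ]) = ≡-recompute _≟_ (sum-blockSums r μ (proj₁ (proj₂ (proj₂ valid))))

-- Sequences with gaps

reverseAcc-Linked : ∀ {R : ℕ → ℕ → Set} acc x xs → Linked (flip R) (x ∷ acc) → Linked R (x ∷ xs) →
                    Linked (flip R) (reverseAcc (x ∷ acc) xs)
reverseAcc-Linked acc x []       racc _          = racc
reverseAcc-Linked acc x (y ∷ ys) racc (Rxy ∷ rs) = reverseAcc-Linked (x ∷ acc) y ys (Rxy ∷ racc) rs

reverse-Linked : ∀ {R : ℕ → ℕ → Set} xs → Linked R xs → Linked (flip R) (reverse xs)
reverse-Linked []       _  = []
reverse-Linked (x ∷ xs) rs = reverseAcc-Linked [] x xs [-] rs

DescBox : ℕ → ℕ → Set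
DescBox N r = Σ (List ℕ) (λ xs → Irrelevant (length xs ≡ r × Descending xs × All (_≤ N) xs))

DescBox↔Box : ∀ N r → DescBox N r ↔ Box N r
DescBox↔Box N r = mk↔ₛ′ rev rev (λ (xs , _) → Σ-≡-irrelevant (reverse-involutive xs)) (λ (xs , _) → Σ-≡-irrelevant (reverse-involutive xs))
  where
  rev : ∀ {R : ℕ → ℕ → Set} → Σ (List ℕ) (λ xs → Irrelevant (length xs ≡ r × Linked R xs × All (_≤ N) xs)) →
        Σ (List ℕ) (λ xs → Irrelevant (length xs ≡ r × Linked (flip R) xs × All (_≤ N) xs))
  rev (xs , [ p ]) = reverse xs ,
    [ trans (length-reverse xs) (proj₁ p) , reverse-Linked xs (proj₁ (proj₂ p)) , All-resp-↭ (↭-sym (↭-reverse xs)) (proj₂ (proj₂ p)) ]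

DescBox↔Box-size : ∀ N r (xs : DescBox N r) → Box-size (Inverse.to (DescBox↔Box N r) xs) ≡ sum (proj₁ xs)
DescBox↔Box-size N r (xs , _) = sum-↭ (↭-reverse xs)

n+nC2≡[1+n]C2 : ∀ n → n + n C 2 ≡ suc n C 2
n+nC2≡[1+n]C2 n = trans (cong (_+ n C 2) (sym (nC1≡n n))) (nCk+nC[k+1]≡[n+1]C[k+1] n 1)

module Staircase (G K : ℕ) where

  Gapped : List ℕ → Set
  Gapped = Linked (λ x y → y + G ≤ x)

  ValidGapped : ℕ → List ℕ → Set
  ValidGapped r xs = length xs ≡ r × Gapped xs × All (_≤ K) xs

  unstair stair : List ℕ → List ℕ
  unstair []       = []
  unstair (x ∷ xs) = (x ∸ G * length xs) ∷ unstair xs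
  stair []       = []
  stair (y ∷ ys) = (y + G * length ys) ∷ stair ys

  length-unstair : ∀ xs → length (unstair xs) ≡ length xs
  length-unstair []       = refl
  length-unstair (x ∷ xs) = cong suc (length-unstair xs)

  length-stair : ∀ ys → length (stair ys) ≡ length ys
  length-stair []       = refl
  length-stair (y ∷ ys) = cong suc (length-stair ys)

  Gapped⇒staircase≤ : ∀ x xs → Gapped (x ∷ xs) → G * length xs ≤ x
  Gapped⇒staircase≤ x []       _           = ≤-trans (≤-reflexive (*-zeroʳ G)) z≤n
  Gapped⇒staircase≤ x (y ∷ xs) (y+G≤x ∷ g) = begin
    G * suc (length xs) ≡⟨ *-suc G (length xs) ⟩
    G + G * length xs   ≤⟨ +-monoʳ-≤ G (Gapped⇒staircase≤ y xs g) ⟩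
    G + y               ≡⟨ +-comm G y ⟩
    y + G               ≤⟨ y+G≤x ⟩
    x                   ∎
    where open ≤-Reasoning

  Gapped⇒Descending : ∀ {xs} → Gapped xs → Descending xs
  Gapped⇒Descending = Linked.map (λ {x} {y} y+G≤x → ≤-trans (m≤m+n y G) y+G≤x)

  stair∘unstair : ∀ xs → Gapped xs → stair (unstair xs) ≡ xs
  stair∘unstair []       _ = refl
  stair∘unstair (x ∷ xs) g = cong₂ _∷_
    (trans (cong (λ n → x ∸ G * length xs + G * n) (length-unstair xs)) (m∸n+n≡m (Gapped⇒staircase≤ x xs g)))
    (stair∘unstair xs (Linked.tail g))

  unstair∘stair : ∀ ys → unstair (stair ys) ≡ ys
  unstair∘stair []       = refl
  unstair∘stair (y ∷ ys) = cong₂ _∷_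
    (trans (cong (λ n → y + G * length ys ∸ G * n) (length-stair ys)) (m+n∸n≡m y (G * length ys)))
    (unstair∘stair ys)

  unstair-Descending : ∀ xs → Gapped xs → Descending (unstair xs)
  unstair-Descending []           _           = []
  unstair-Descending (x ∷ [])     _           = [-]
  unstair-Descending (x ∷ y ∷ xs) (y+G≤x ∷ g) = step ∷ unstair-Descending (y ∷ xs) g
    where
    n = length xs
    step : y ∸ G * n ≤ x ∸ G * suc n
    step = m+n≤o⇒m≤o∸n (y ∸ G * n) (begin
      y ∸ G * n + G * suc n   ≡⟨ cong (y ∸ G * n +_) (*-suc G n) ⟩
      y ∸ G * n + (G + G * n) ≡⟨ x∙yz≈y∙xz (y ∸ G * n) G (G * n) ⟩
      G + (y ∸ G * n + G * n) ≡⟨ cong (G +_) (m∸n+n≡m (Gapped⇒staircase≤ y xs g)) ⟩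
      G + y                   ≡⟨ +-comm G y ⟩
      y + G                   ≤⟨ y+G≤x ⟩
      x                       ∎)
      where open ≤-Reasoning

  stair-Gapped : ∀ ys → Descending ys → Gapped (stair ys)
  stair-Gapped []           _         = []
  stair-Gapped (y ∷ [])     _         = [-]
  stair-Gapped (y ∷ z ∷ ys) (z≤y ∷ d) = subst₂ _≤_ (regroup z G n) (cong (y +_) (sym (*-suc G n))) (+-monoˡ-≤ (G + G * n) z≤y)
                                        ∷ stair-Gapped (z ∷ ys) d
    where
    n = length ys
    regroup : ∀ z G n → z + (G + G * n) ≡ z + G * n + G
    regroup = solve-∀

  sum-stair : ∀ ys → sum (stair ys) ≡ G * (length ys C 2) + sum ys
  sum-stair []       = sym (trans (+-identityʳ (G * 0)) (*-zeroʳ G))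
  sum-stair (y ∷ ys) = begin
    y + G * length ys + sum (stair ys)                 ≡⟨ cong (y + G * length ys +_) (sum-stair ys) ⟩
    y + G * length ys + (G * (length ys C 2) + sum ys) ≡⟨ regroup y (G * length ys) (G * (length ys C 2)) (sum ys) ⟩
    G * length ys + G * (length ys C 2) + (y + sum ys) ≡⟨ cong (_+ (y + sum ys)) (sym (*-distribˡ-+ G (length ys) _)) ⟩
    G * (length ys + length ys C 2) + (y + sum ys)     ≡⟨ cong (λ c → G * c + (y + sum ys)) (n+nC2≡[1+n]C2 (length ys)) ⟩
    G * (suc (length ys) C 2) + (y + sum ys)           ∎
    where
    open ≡-Reasoning
    regroup : ∀ a b c d → a + b + (c + d) ≡ b + c + (a + d)
    regroup = solve-∀

  GappedSeqs : ℕ → Set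
  GappedSeqs r = Σ (List ℕ) (λ xs → Irrelevant (ValidGapped r xs))

  module _ (r : ℕ) (fits : G * (r ∸ 1) ≤ K) where

    width : ℕ
    width = K ∸ G * (r ∸ 1)

    unstair-≤ : ∀ xs → length xs ≡ r → Gapped xs → All (_≤ K) xs → All (_≤ width) (unstair xs)
    unstair-≤ []       _   _ _       = []
    unstair-≤ (x ∷ xs) len g (x≤K ∷ _) =
      All.++⁺ {xs = _ ∷ []} (head≤ ∷ []) (All.map (λ y≤ → ≤-trans y≤ head≤) (Descending⇒≤head (unstair-Descending (x ∷ xs) g)))
      where
      head≤ : x ∸ G * length xs ≤ width
      head≤ = subst (λ n → x ∸ G * length xs ≤ K ∸ G * n) (cong (_∸ 1) len) (∸-monoˡ-≤ (G * length xs) x≤K)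

    stair-≤ : ∀ ys → length ys ≡ r → Descending ys → All (_≤ width) ys → All (_≤ K) (stair ys)
    stair-≤ []       _   _ _         = []
    stair-≤ (y ∷ ys) len d (y≤w ∷ _) =
      head≤ ∷ All.map (λ z≤ → ≤-trans z≤ head≤) (Descending⇒≤head (Gapped⇒Descending (stair-Gapped (y ∷ ys) d)))
      where
      head≤ : y + G * length ys ≤ K
      head≤ = ≤-trans (+-monoˡ-≤ (G * length ys) y≤w)
        (≤-reflexive (trans (cong (λ n → width + G * n) (cong (_∸ 1) len)) (m∸n+n≡m fits)))

    GappedSeqs↔DescBox : GappedSeqs r ↔ DescBox width r
    GappedSeqs↔DescBox = mk↔ₛ′
      (λ (xs , [ p ]) → unstair xs ,
        [ trans (length-unstair xs) (proj₁ p) , unstair-Descending xs (proj₁ (proj₂ p)) , unstair-≤ xs (proj₁ p) (proj₁ (proj₂ p)) (proj₂ (proj₂ p)) ])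
      (λ (ys , [ p ]) → stair ys ,
        [ trans (length-stair ys) (proj₁ p) , stair-Gapped ys (proj₁ (proj₂ p)) , stair-≤ ys (proj₁ p) (proj₁ (proj₂ p)) (proj₂ (proj₂ p)) ])
      (λ (ys , _) → Σ-≡-irrelevant (unstair∘stair ys))
      (λ (xs , [ p ]) → Σ-≡-irrelevant (≡-recompute (≡-dec _≟_) (stair∘unstair xs (proj₁ (proj₂ p)))))

    GappedSeqs↔DescBox-size : ∀ (xs : GappedSeqs r) →
                              G * (r C 2) + sum (proj₁ (Inverse.to GappedSeqs↔DescBox xs)) ≡ sum (proj₁ xs)
    GappedSeqs↔DescBox-size (xs , [ p ]) = ≡-recompute _≟_ (begin
      G * (r C 2) + sum (unstair xs)                   ≡⟨ cong (λ n → G * (n C 2) + sum (unstair xs)) (sym (trans (length-unstair xs) (proj₁ p))) ⟩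
      G * (length (unstair xs) C 2) + sum (unstair xs) ≡⟨ sym (sum-stair (unstair xs)) ⟩
      sum (stair (unstair xs))                         ≡⟨ cong sum (stair∘unstair xs (proj₁ (proj₂ p))) ⟩
      sum xs                                           ∎)
      where open ≡-Reasoning

  GappedSeqs-empty : ∀ r → 1 ≤ r → K < G * (r ∸ 1) → ¬ GappedSeqs r
  GappedSeqs-empty r 1≤r K< ([]     , [ p ]) = ⊥-elim-irr (<⇒≱ 1≤r (≤-reflexive (sym (proj₁ p))))
  GappedSeqs-empty r 1≤r K< (x ∷ xs , [ p ]) = ⊥-elim-irr (<⇒≱ K< (begin
    G * (r ∸ 1)         ≡⟨ cong (λ n → G * (n ∸ 1)) (sym (proj₁ p)) ⟩
    G * length xs       ≤⟨ Gapped⇒staircase≤ x xs (proj₁ (proj₂ p)) ⟩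
    x                   ≤⟨ All.head (proj₂ (proj₂ p)) ⟩
    K                   ∎))
    where open ≤-Reasoning

module _ (L D a : ℕ) .{{_ : NonZero L}} where
  open Blocks L D a
  open Staircase (D * L) (a * L)

  Rows↔Box : ∀ r → 1 ≤ D → (fits : D * L * (r ∸ 1) ≤ a * L) → Rows r ↔ Box (width r fits) r
  Rows↔Box r 1≤D fits = ↔-trans (Rows↔Sums r 1≤D) (↔-trans (GappedSeqs↔DescBox r fits) (DescBox↔Box _ r))

  Rows↔Box-size : ∀ r (1≤D : 1 ≤ D) (fits : D * L * (r ∸ 1) ≤ a * L) (μ : Rows r) →
                  D * L * (r C 2) + Box-size (Inverse.to (Rows↔Box r 1≤D fits) μ) ≡ sum (proj₁ μ)
  Rows↔Box-size r 1≤D fits μ = begin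
    D * L * (r C 2) + Box-size (Inverse.to (DescBox↔Box _ r) descBox) ≡⟨ cong (D * L * (r C 2) +_) (DescBox↔Box-size _ r descBox) ⟩
    D * L * (r C 2) + sum (proj₁ descBox)                              ≡⟨ GappedSeqs↔DescBox-size r fits sums ⟩
    sum (proj₁ sums)                                                   ≡⟨ Rows↔Sums-size r 1≤D μ ⟩
    sum (proj₁ μ)                                                      ∎
    where
    open ≡-Reasoning
    sums = Inverse.to (Rows↔Sums r 1≤D) μ
    descBox = Inverse.to (GappedSeqs↔DescBox r fits) sums

  Rows-empty : ∀ r → 1 ≤ D → 1 ≤ r → a * L < D * L * (r ∸ 1) → ¬ Rows r
  Rows-empty r 1≤D 1≤r overfull μ = GappedSeqs-empty r 1≤r overfull (Inverse.to (Rows↔Sums r 1≤D) μ)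

-- MacMahon diagrams as pairs of partitions

Row : Set
Row = ℕ × ℕ

-- Rows sorted by length, ties broken by putting higher labels first; this is exactly
-- what the column condition says about the rows of a MacMahon diagram.
_≽_ : Row → Row → Set
(x , ℓ) ≽ (y , ℓ′) = y ≤ x × (y ≡ x → ℓ′ ≤ ℓ)

Labelled : Row → Set
Labelled (_ , ℓ) = 1 ≤ ℓ × ℓ ≤ 2

rowsLabelledWith : ℕ → List Row → List ℕ
rowsLabelledWith ℓ []             = []
rowsLabelledWith ℓ ((x , ℓ′) ∷ P) = if ℓ′ ≡ᵇ ℓ then x ∷ rowsLabelledWith ℓ P else rowsLabelledWith ℓ P

unmarked marked : List ℕ → List Row
unmarked = map (_, 2)
marked   = map (_, 1)

merge : List ℕ → List ℕ → List Row
merge []      ν       = marked ν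
merge (x ∷ μ) []      = unmarked (x ∷ μ)
merge (x ∷ μ) (y ∷ ν) = if y ≤ᵇ x then (x , 2) ∷ merge μ (y ∷ ν) else (y , 1) ∷ merge (x ∷ μ) ν

merge-[] : ∀ μ → merge μ [] ≡ unmarked μ
merge-[] []      = refl
merge-[] (_ ∷ _) = refl

if-reflects : ∀ {Q A : Set} (P : A → Set) {b : Bool} {t e : A} → Reflects Q b → (Q → P t) → (¬ Q → P e) →
              P (if b then t else e)
if-reflects P (ofʸ q)  pt _  = pt q
if-reflects P (ofⁿ ¬q) _  pe = pe ¬q

unmarked-merge : ∀ μ ν → rowsLabelledWith 2 (merge μ ν) ≡ μ
unmarked-merge []      []      = refl
unmarked-merge []      (y ∷ ν) = unmarked-merge [] ν
unmarked-merge (x ∷ μ) []      = cong (x ∷_) (trans (cong (rowsLabelledWith 2) (sym (merge-[] μ))) (unmarked-merge μ []))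
unmarked-merge (x ∷ μ) (y ∷ ν) = if-reflects (λ P → rowsLabelledWith 2 P ≡ x ∷ μ) (≤ᵇ-reflects-≤ y x)
  (λ _ → cong (x ∷_) (unmarked-merge μ (y ∷ ν))) (λ _ → unmarked-merge (x ∷ μ) ν)

marked-merge : ∀ μ ν → rowsLabelledWith 1 (merge μ ν) ≡ ν
marked-merge []      []      = refl
marked-merge []      (y ∷ ν) = cong (y ∷_) (marked-merge [] ν)
marked-merge (x ∷ μ) []      = trans (cong (rowsLabelledWith 1) (sym (merge-[] μ))) (marked-merge μ [])
marked-merge (x ∷ μ) (y ∷ ν) = if-reflects (λ P → rowsLabelledWith 1 P ≡ y ∷ ν) (≤ᵇ-reflects-≤ y x)
  (λ _ → marked-merge μ (y ∷ ν)) (λ _ → cong (y ∷_) (marked-merge (x ∷ μ) ν))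

length-merge : ∀ μ ν → length (merge μ ν) ≡ length μ + length ν
length-merge []      ν       = length-map _ ν
length-merge (x ∷ μ) []      = cong suc (trans (length-map _ μ) (sym (+-identityʳ _)))
length-merge (x ∷ μ) (y ∷ ν) = if-reflects (λ P → length P ≡ suc (length μ + suc (length ν))) (≤ᵇ-reflects-≤ y x)
  (λ _ → cong suc (length-merge μ (y ∷ ν)))
  (λ _ → cong suc (trans (length-merge (x ∷ μ) ν) (sym (+-suc (length μ) (length ν)))))

merge-All : ∀ {Q : Row → Set} μ ν → All (Q ∘ (_, 2)) μ → All (Q ∘ (_, 1)) ν → All Q (merge μ ν)
merge-All []      ν       _         qν        = All.map⁺ qν
merge-All (x ∷ μ) []      qμ        _         = All.map⁺ qμ
merge-All {Q} (x ∷ μ) (y ∷ ν) (qx ∷ qμ) (qy ∷ qν) = if-reflects (All Q) (≤ᵇ-reflects-≤ y x)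
  (λ _ → qx ∷ merge-All μ (y ∷ ν) qμ (qy ∷ qν)) (λ _ → qy ∷ merge-All (x ∷ μ) ν (qx ∷ qμ) qν)

map-sorted : ∀ ℓ ν → Descending ν → AllPairs _≽_ (map (_, ℓ) ν)
map-sorted ℓ []      _ = []
map-sorted ℓ (y ∷ ν) d = All.map⁺ (All.map (λ z≤y → z≤y , λ _ → ≤-refl) (Descending⇒≤head d)) ∷ map-sorted ℓ ν (Linked.tail d)

unmarked-head-≽ : ∀ {x y μ ν} → y ≤ x → Descending (x ∷ μ) → Descending (y ∷ ν) → All ((x , 2) ≽_) (merge μ (y ∷ ν))
unmarked-head-≽ {μ = μ} {ν} y≤x dμ dν =
  merge-All μ (_ ∷ ν) (All.map (λ z≤x → z≤x , λ _ → ≤-refl) (Descending⇒≤head dμ))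
                      (All.map (λ z≤y → ≤-trans z≤y y≤x , λ _ → s≤s z≤n) (≤-refl ∷ Descending⇒≤head dν))

marked-head-≽ : ∀ {x y μ ν} → x < y → Descending (x ∷ μ) → Descending (y ∷ ν) → All ((y , 1) ≽_) (merge (x ∷ μ) ν)
marked-head-≽ {μ = μ} {ν} x<y dμ dν =
  merge-All (_ ∷ μ) ν (All.map (λ z≤x → ≤-trans z≤x (<⇒≤ x<y) , λ z≡y → ⊥-elim (<⇒≢ (≤-<-trans z≤x x<y) z≡y))
                               (≤-refl ∷ Descending⇒≤head dμ))
                      (All.map (λ z≤y → z≤y , λ _ → ≤-refl) (Descending⇒≤head dν))

merge-sorted : ∀ μ ν → Descending μ → Descending ν → AllPairs _≽_ (merge μ ν)
merge-sorted []      ν       _  dν = map-sorted 1 ν dν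
merge-sorted (x ∷ μ) []      dμ _  = map-sorted 2 (x ∷ μ) dμ
merge-sorted (x ∷ μ) (y ∷ ν) dμ dν = if-reflects (AllPairs _≽_) (≤ᵇ-reflects-≤ y x)
  (λ y≤x → unmarked-head-≽ y≤x dμ dν ∷ merge-sorted μ (y ∷ ν) (Linked.tail dμ) dν)
  (λ y≰x → marked-head-≽ (≰⇒> y≰x) dμ dν ∷ merge-sorted (x ∷ μ) ν dμ (Linked.tail dν))

rowsLabelledWith-All : ∀ ℓ {Q : ℕ → Set} P → All (Q ∘ proj₁) P → All Q (rowsLabelledWith ℓ P)
rowsLabelledWith-All ℓ []             _        = []
rowsLabelledWith-All ℓ ((x , ℓ′) ∷ P) (q ∷ qs) with ℓ′ ≡ᵇ ℓ
... | true  = q ∷ rowsLabelledWith-All ℓ P qs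
... | false = rowsLabelledWith-All ℓ P qs

rowsLabelledWith-Descending : ∀ ℓ P → AllPairs _≽_ P → Descending (rowsLabelledWith ℓ P)
rowsLabelledWith-Descending ℓ []             _        = []
rowsLabelledWith-Descending ℓ ((x , ℓ′) ∷ P) (≼x ∷ s) with ℓ′ ≡ᵇ ℓ
... | true  = ∷-Descending (rowsLabelledWith-All ℓ P (All.map proj₁ ≼x)) (rowsLabelledWith-Descending ℓ P s)
... | false = rowsLabelledWith-Descending ℓ P s

merge-marked-head : ∀ x μ ν → All (_< x) μ → merge μ (x ∷ ν) ≡ (x , 1) ∷ merge μ ν
merge-marked-head x []      ν _         = refl
merge-marked-head x (z ∷ μ) ν (z<x ∷ _) with x ≤ᵇ z | ≤ᵇ-reflects-≤ x z
... | true  | ofʸ x≤z = ⊥-elim (<⇒≱ z<x x≤z)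
... | false | _       = refl

merge-unmarked-head : ∀ x μ ν → All (_≤ x) ν → merge (x ∷ μ) ν ≡ (x , 2) ∷ merge μ ν
merge-unmarked-head x μ []      _         = cong ((x , 2) ∷_) (sym (merge-[] μ))
merge-unmarked-head x μ (y ∷ ν) (y≤x ∷ _) with y ≤ᵇ x | ≤ᵇ-reflects-≤ y x
... | true  | _        = refl
... | false | ofⁿ y≰x = ⊥-elim (y≰x y≤x)

unmarked-below-marked : ∀ x P → All ((x , 1) ≽_) P → All (_< x) (rowsLabelledWith 2 P)
unmarked-below-marked x []             _                = []
unmarked-below-marked x ((z , ℓ) ∷ P) ((z≤x , tie) ∷ ps) with ℓ ≡ᵇ 2 in ℓ≡ᵇ2
... | true  = ≤∧≢⇒< z≤x (λ z≡x → 1+n≰n (subst (_≤ 1) (≡ᵇ⇒≡ ℓ 2 (subst T (sym ℓ≡ᵇ2) tt)) (tie z≡x)))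
              ∷ unmarked-below-marked x P ps
... | false = unmarked-below-marked x P ps

merge-split : ∀ P → AllPairs _≽_ P → All Labelled P → merge (rowsLabelledWith 2 P) (rowsLabelledWith 1 P) ≡ P
merge-split []                        _        _                = refl
merge-split ((x , 1) ∷ P)             (≼x ∷ s) (_ ∷ labelled) =
  trans (merge-marked-head x _ _ (unmarked-below-marked x P ≼x)) (cong ((x , 1) ∷_) (merge-split P s labelled))
merge-split ((x , 2) ∷ P)             (≼x ∷ s) (_ ∷ labelled) =
  trans (merge-unmarked-head x _ _ (rowsLabelledWith-All 1 P (All.map proj₁ ≼x))) (cong ((x , 2) ∷_) (merge-split P s labelled))
merge-split ((x , 0) ∷ P)             _        ((() , _) ∷ _)
merge-split ((x , suc (suc (suc _))) ∷ P) _    ((_ , s≤s (s≤s ())) ∷ _)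

zipRows : ∀ {b} → Vec ℕ b → Vec ℕ b → List Row
zipRows []       []       = []
zipRows (x ∷ xs) (y ∷ ys) = (x , y) ∷ zipRows xs ys

rowLengths rowLabels : ∀ {b} (P : List Row) → .(length P ≡ b) → Vec ℕ b
rowLengths {zero}  []      _ = []
rowLengths {suc b} []      e = ⊥-elim-irr (0≢1+n e)
rowLengths {zero}  (_ ∷ _) e = ⊥-elim-irr (1+n≢0 e)
rowLengths {suc b} (r ∷ P) e = proj₁ r ∷ rowLengths P (suc-injective e)
rowLabels  {zero}  []      _ = []
rowLabels  {suc b} []      e = ⊥-elim-irr (0≢1+n e)
rowLabels  {zero}  (_ ∷ _) e = ⊥-elim-irr (1+n≢0 e)
rowLabels  {suc b} (r ∷ P) e = proj₂ r ∷ rowLabels P (suc-injective e)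

zipRows-unzip : ∀ {b} (P : List Row) .(e : length P ≡ b) → zipRows (rowLengths P e) (rowLabels P e) ≡ P
zipRows-unzip {zero}  []      _ = refl
zipRows-unzip {suc b} []      e = ⊥-elim-irr (0≢1+n e)
zipRows-unzip {zero}  (_ ∷ _) e = ⊥-elim-irr (1+n≢0 e)
zipRows-unzip {suc b} (r ∷ P) e = cong (r ∷_) (zipRows-unzip P (suc-injective e))

rowLengths-zipRows : ∀ {b} (xs ys : Vec ℕ b) .(e : length (zipRows xs ys) ≡ b) → rowLengths (zipRows xs ys) e ≡ xs
rowLengths-zipRows []       []       _ = refl
rowLengths-zipRows (x ∷ xs) (y ∷ ys) e = cong (x ∷_) (rowLengths-zipRows xs ys (suc-injective e))

rowLabels-zipRows : ∀ {b} (xs ys : Vec ℕ b) .(e : length (zipRows xs ys) ≡ b) → rowLabels (zipRows xs ys) e ≡ ys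
rowLabels-zipRows []       []       _ = refl
rowLabels-zipRows (x ∷ xs) (y ∷ ys) e = cong (y ∷_) (rowLabels-zipRows xs ys (suc-injective e))

rowLengths-≡ : ∀ {b} {P : List Row} (xs ys : Vec ℕ b) .(e : length P ≡ b) → P ≡ zipRows xs ys → rowLengths P e ≡ xs
rowLengths-≡ xs ys e refl = rowLengths-zipRows xs ys e

rowLabels-≡ : ∀ {b} {P : List Row} (xs ys : Vec ℕ b) .(e : length P ≡ b) → P ≡ zipRows xs ys → rowLabels P e ≡ ys
rowLabels-≡ xs ys e refl = rowLabels-zipRows xs ys e

length-zipRows : ∀ {b} (xs ys : Vec ℕ b) → length (zipRows xs ys) ≡ b
length-zipRows []       []       = refl
length-zipRows (x ∷ xs) (y ∷ ys) = cong suc (length-zipRows xs ys)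

sum-zipRows : ∀ {b} (xs ys : Vec ℕ b) → sum (Vec.toList xs) ≡ sum (map proj₁ (zipRows xs ys))
sum-zipRows []       []       = refl
sum-zipRows (x ∷ xs) (y ∷ ys) = cong (x +_) (sum-zipRows xs ys)

zipRows-All⁺ : ∀ {b} {Q : Row → Set} (xs ys : Vec ℕ b) → (∀ i → Q (Vec.lookup xs i , Vec.lookup ys i)) → All Q (zipRows xs ys)
zipRows-All⁺ []       []       _ = []
zipRows-All⁺ (x ∷ xs) (y ∷ ys) q = q fzero ∷ zipRows-All⁺ xs ys (q ∘ fsuc)

zipRows-All⁻ : ∀ {b} {Q : Row → Set} (xs ys : Vec ℕ b) → All Q (zipRows xs ys) → ∀ i → Q (Vec.lookup xs i , Vec.lookup ys i)
zipRows-All⁻ (x ∷ xs) (y ∷ ys) (q ∷ _)  fzero    = q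
zipRows-All⁻ (x ∷ xs) (y ∷ ys) (_ ∷ qs) (fsuc i) = zipRows-All⁻ xs ys qs i

rows : ∀ {a b} → MacMahon a b → List Row
rows Υ = zipRows (len Υ) (lab Υ)

diagramTail : ∀ {a b} {x y : ℕ} {xs ys : Vec ℕ b} (Υ : MacMahon a (suc b)) → len Υ ≡ x ∷ xs → lab Υ ≡ y ∷ ys → MacMahon a b
diagramTail {xs = xs} {ys} (mkDiagram _ _ lab-range len-dec len-bound col-dec) refl refl =
  mkDiagram xs ys (lab-range ∘ fsuc) (λ i j i≤j → len-dec (fsuc i) (fsuc j) (s≤s i≤j)) (len-bound ∘ fsuc)
                  (λ i i′ c i<i′ → col-dec (fsuc i) (fsuc i′) c (s≤s i<i′))

rowsLabeled≡ : ∀ {a b} ℓ (Υ : MacMahon a b) → rowsLabeled ℓ Υ ≡ rowsLabelledWith ℓ (rows Υ)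
rowsLabeled≡ {b = zero}  ℓ (mkDiagram [] [] _ _ _ _) = refl
rowsLabeled≡ {b = suc b} ℓ Υ@(mkDiagram (x ∷ xs) (y ∷ ys) _ _ _ _) with y ≡ᵇ ℓ
... | true  = cong (x ∷_) (rowsLabeled≡ ℓ (diagramTail Υ refl refl))
... | false = rowsLabeled≡ ℓ (diagramTail Υ refl refl)

ColumnCondition : ∀ {b} → Vec ℕ b → Vec ℕ b → Set
ColumnCondition {b} lens labs = ∀ (i i′ : Fin b) c → i Fin.< i′ → c ≤ Vec.lookup lens i′ →
                                cellLabel 2 lens labs i′ c ≤ cellLabel 2 lens labs i c

≡ᵇ-refl : ∀ c → T (c ≡ᵇ c)
≡ᵇ-refl c = ≡⇒≡ᵇ c c refl

diagram-sorted : ∀ {b} (lens labs : Vec ℕ b) → (∀ (i j : Fin b) → i Fin.≤ j → Vec.lookup lens j ≤ Vec.lookup lens i) →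
                 ColumnCondition lens labs → AllPairs _≽_ (zipRows lens labs)
diagram-sorted []         []         _       _       = []
diagram-sorted (x ∷ lens) (y ∷ labs) len-dec col-dec =
  zipRows-All⁺ lens labs (λ j → len-dec fzero (fsuc j) z≤n , tie j)
  ∷ diagram-sorted lens labs (λ i j i≤j → len-dec (fsuc i) (fsuc j) (s≤s i≤j)) (λ i i′ c i<i′ → col-dec (fsuc i) (fsuc i′) c (s≤s i<i′))
  where
  tie : ∀ j → Vec.lookup lens j ≡ x → Vec.lookup labs j ≤ y
  tie j lj≡x = subst₂ _≤_ lower upper (col-dec fzero (fsuc j) (Vec.lookup lens j) (s≤s z≤n) ≤-refl)
    where
    lower : cellLabel 2 (x ∷ lens) (y ∷ labs) (fsuc j) (Vec.lookup lens j) ≡ Vec.lookup labs j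
    lower rewrite Equivalence.to T-≡ (≡ᵇ-refl (Vec.lookup lens j)) = refl
    upper : cellLabel 2 (x ∷ lens) (y ∷ labs) fzero (Vec.lookup lens j) ≡ y
    upper rewrite Equivalence.to T-≡ (≡⇒≡ᵇ _ _ lj≡x) = refl

sorted-≽ : ∀ {b} (lens labs : Vec ℕ b) → AllPairs _≽_ (zipRows lens labs) → ∀ (i j : Fin b) → i Fin.< j →
           (Vec.lookup lens i , Vec.lookup labs i) ≽ (Vec.lookup lens j , Vec.lookup labs j)
sorted-≽ (x ∷ lens) (y ∷ labs) (≼x ∷ _) fzero    (fsuc j) _         = zipRows-All⁻ lens labs ≼x j
sorted-≽ (x ∷ lens) (y ∷ labs) (_ ∷ s)  (fsuc i) (fsuc j) (s≤s i<j) = sorted-≽ lens labs s i j i<j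

sorted⇒lengths-decreasing : ∀ {b} (lens labs : Vec ℕ b) → AllPairs _≽_ (zipRows lens labs) →
                            ∀ (i j : Fin b) → i Fin.≤ j → Vec.lookup lens j ≤ Vec.lookup lens i
sorted⇒lengths-decreasing lens labs s i j i≤j with m≤n⇒m<n∨m≡n i≤j
... | inj₁ i<j = proj₁ (sorted-≽ lens labs s i j i<j)
... | inj₂ i≡j rewrite Finₚ.toℕ-injective i≡j = ≤-refl

sorted⇒ColumnCondition : ∀ {b} (lens labs : Vec ℕ b) → AllPairs _≽_ (zipRows lens labs) →
                         All Labelled (zipRows lens labs) → ColumnCondition lens labs
sorted⇒ColumnCondition lens labs s labelled i i′ c i<i′ c≤ with sorted-≽ lens labs s i i′ i<i′
... | shorter , tie with c ≡ᵇ Vec.lookup lens i′ in at-end′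
...   | true with c ≡ᵇ Vec.lookup lens i in at-end
...     | true  = tie (trans (sym (≡ᵇ⇒≡ c _ (Equivalence.from T-≡ at-end′))) (≡ᵇ⇒≡ c _ (Equivalence.from T-≡ at-end)))
...     | false = proj₂ (zipRows-All⁻ lens labs labelled i′)
sorted⇒ColumnCondition lens labs s labelled i i′ c i<i′ c≤ | shorter , tie | false with c ≡ᵇ Vec.lookup lens i in at-end
...     | true  = ⊥-elim (<⇒≱ (≤-<-trans (≤-reflexive (sym (≡ᵇ⇒≡ c _ (Equivalence.from T-≡ at-end)))) c<) shorter)
  where
  c< : c < Vec.lookup lens i′
  c< = ≤∧≢⇒< c≤ (λ c≡ → subst T at-end′ (≡⇒≡ᵇ c _ c≡))
...     | false = ≤-refl

length-split : ∀ P → All Labelled P → length (rowsLabelledWith 2 P) + length (rowsLabelledWith 1 P) ≡ length P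
length-split []                            _                  = refl
length-split ((x , 1) ∷ P)                 (_ ∷ labelled)     = trans (+-suc _ _) (cong suc (length-split P labelled))
length-split ((x , 2) ∷ P)                 (_ ∷ labelled)     = cong suc (length-split P labelled)
length-split ((x , 0) ∷ P)                 ((() , _) ∷ _)
length-split ((x , suc (suc (suc _))) ∷ P) ((_ , s≤s (s≤s ())) ∷ _)

sum-split : ∀ P → All Labelled P → sum (map proj₁ P) ≡ sum (rowsLabelledWith 2 P) + sum (rowsLabelledWith 1 P)
sum-split []                            _              = refl
sum-split ((x , 1) ∷ P)                 (_ ∷ labelled) =
  trans (cong (x +_) (sum-split P labelled)) (x∙yz≈y∙xz x (sum (rowsLabelledWith 2 P)) _)
sum-split ((x , 2) ∷ P)                 (_ ∷ labelled) = trans (cong (x +_) (sum-split P labelled)) (sym (+-assoc x _ _))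
sum-split ((x , 0) ∷ P)                 ((() , _) ∷ _)
sum-split ((x , suc (suc (suc _))) ∷ P) ((_ , s≤s (s≤s ())) ∷ _)

diagram-≡ : ∀ {a b} (Υ Υ′ : MacMahon a b) → len Υ ≡ len Υ′ → lab Υ ≡ lab Υ′ → Υ ≡ Υ′
diagram-≡ (mkDiagram _ _ _ _ _ _) (mkDiagram _ _ _ _ _ _) refl refl = refl

ValidPair : ℕ → ℕ → List ℕ × List ℕ → Set
ValidPair a b (ν , μ) = Descending ν × Descending μ × All (_≤ a) ν × All (_≤ a) μ × length μ + length ν ≡ b

RowPairs : ℕ → ℕ → Set
RowPairs a b = Σ (List ℕ × List ℕ) (λ νμ → Irrelevant (ValidPair a b νμ))

module _ {a b : ℕ} where

  rows-valid : (lens labs : Vec ℕ b) → (∀ i → Labelled (Vec.lookup lens i , Vec.lookup labs i)) →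
               (∀ (i j : Fin b) → i Fin.≤ j → Vec.lookup lens j ≤ Vec.lookup lens i) → (∀ i → Vec.lookup lens i ≤ a) →
               ColumnCondition lens labs →
               ValidPair a b (rowsLabelledWith 1 (zipRows lens labs) , rowsLabelledWith 2 (zipRows lens labs))
  rows-valid lens labs labelled len-dec len-bound col-dec =
    rowsLabelledWith-Descending 1 P sorted , rowsLabelledWith-Descending 2 P sorted ,
    rowsLabelledWith-All 1 P bounded , rowsLabelledWith-All 2 P bounded ,
    trans (length-split P (zipRows-All⁺ lens labs labelled)) (length-zipRows lens labs)
    where
    P = zipRows lens labs
    sorted : AllPairs _≽_ P
    sorted = diagram-sorted lens labs len-dec col-dec
    bounded : All ((_≤ a) ∘ proj₁) P
    bounded = zipRows-All⁺ lens labs len-bound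

  diagram-valid : (Υ : MacMahon a b) → Irrelevant (ValidPair a b (markedRows Υ , unmarkedRows Υ))
  diagram-valid Υ@(mkDiagram lens labs labelled len-dec len-bound col-dec) =
    [ subst (ValidPair a b) (sym (cong₂ _,_ (rowsLabeled≡ 1 Υ) (rowsLabeled≡ 2 Υ)))
            (rows-valid lens labs labelled len-dec len-bound col-dec) ]

  fromRowPair : ∀ ν μ → .(ValidPair a b (ν , μ)) → MacMahon a b
  fromRowPair ν μ valid = mkDiagram lens labs
    (zipRows-All⁻ lens labs (subst (All Labelled) (sym P≡) labelled-P))
    (sorted⇒lengths-decreasing lens labs (subst (AllPairs _≽_) (sym P≡) (sorted-P valid)))
    (zipRows-All⁻ lens labs (subst (All ((_≤ a) ∘ proj₁)) (sym P≡) (bounded-P valid)))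
    (sorted⇒ColumnCondition lens labs (subst (AllPairs _≽_) (sym P≡) (sorted-P valid)) (subst (All Labelled) (sym P≡) labelled-P))
    where
    P = merge μ ν
    length≡ : ValidPair a b (ν , μ) → length P ≡ b
    length≡ (_ , _ , _ , _ , μν≡b) = trans (length-merge μ ν) μν≡b
    lens = rowLengths P (length≡ valid)
    labs = rowLabels P (length≡ valid)
    P≡ : zipRows lens labs ≡ P
    P≡ = zipRows-unzip P (length≡ valid)
    sorted-P : ValidPair a b (ν , μ) → AllPairs _≽_ P
    sorted-P (dν , dμ , _) = merge-sorted μ ν dμ dν
    bounded-P : ValidPair a b (ν , μ) → All ((_≤ a) ∘ proj₁) P
    bounded-P (_ , _ , ν≤a , μ≤a , _) = merge-All μ ν μ≤a ν≤a
    labelled-P : All Labelled P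
    labelled-P = merge-All μ ν (All.universal (λ _ → s≤s z≤n , ≤-refl) μ) (All.universal (λ _ → ≤-refl , s≤s z≤n) ν)

  MacMahon↔RowPairs : MacMahon a b ↔ RowPairs a b
  MacMahon↔RowPairs = mk↔ₛ′ to′ from′ to∘from from∘to
    where
    to′ : MacMahon a b → RowPairs a b
    to′ Υ = (markedRows Υ , unmarkedRows Υ) , diagram-valid Υ
    from′ : RowPairs a b → MacMahon a b
    from′ ((ν , μ) , [ valid ]) = fromRowPair ν μ valid
    to∘from : ∀ νμ → to′ (from′ νμ) ≡ νμ
    to∘from ((ν , μ) , [ valid ]) = Σ-≡-irrelevant (cong₂ _,_
      (trans (rowsLabeled≡ 1 Υ) (trans (cong (rowsLabelledWith 1) rows≡) (marked-merge μ ν)))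
      (trans (rowsLabeled≡ 2 Υ) (trans (cong (rowsLabelledWith 2) rows≡) (unmarked-merge μ ν))))
      where
      Υ = fromRowPair ν μ valid
      rows≡ : rows Υ ≡ merge μ ν
      rows≡ = zipRows-unzip (merge μ ν) (trans (length-merge μ ν) (proj₂ (proj₂ (proj₂ (proj₂ valid)))))
    from∘to : ∀ Υ → from′ (to′ Υ) ≡ Υ
    from∘to Υ@(mkDiagram lens labs labelled len-dec _ col-dec) = diagram-≡ _ _
      (rowLengths-≡ lens labs (trans (cong length merged≡) (length-zipRows lens labs)) merged≡)
      (rowLabels-≡ lens labs (trans (cong length merged≡) (length-zipRows lens labs)) merged≡)
      where
      merged≡ : merge (unmarkedRows Υ) (markedRows Υ) ≡ rows Υ
      merged≡ = ≡-recompute (≡-dec (Product.≡-dec _≟_ _≟_)) (trans (cong₂ merge (rowsLabeled≡ 2 Υ) (rowsLabeled≡ 1 Υ))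
        (merge-split (rows Υ) (diagram-sorted lens labs len-dec col-dec) (zipRows-All⁺ lens labs labelled)))

size≡marked+unmarked : ∀ {a b} (Υ : MacMahon a b) → size Υ ≡ sum (markedRows Υ) + sum (unmarkedRows Υ)
size≡marked+unmarked Υ@(mkDiagram lens labs labelled _ _ _) = ≡-recompute _≟_ (begin
  sum (Vec.toList lens)                                           ≡⟨ sum-zipRows lens labs ⟩
  sum (map proj₁ (rows Υ))                                        ≡⟨ sum-split (rows Υ) (zipRows-All⁺ lens labs labelled) ⟩
  sum (rowsLabelledWith 2 (rows Υ)) + sum (rowsLabelledWith 1 (rows Υ)) ≡⟨ +-comm (sum (rowsLabelledWith 2 (rows Υ))) _ ⟩
  sum (rowsLabelledWith 1 (rows Υ)) + sum (rowsLabelledWith 2 (rows Υ)) ≡⟨ sym (cong₂ (λ u w → sum u + sum w) (rowsLabeled≡ 1 Υ) (rowsLabeled≡ 2 Υ)) ⟩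
  sum (markedRows Υ) + sum (unmarkedRows Υ)                       ∎)
  where open ≡-Reasoning

module ConstrainedDiagrams (a b rₘ Lₘ Dₘ rᵤ Lᵤ Dᵤ : ℕ) .{{_ : NonZero Lₘ}} .{{_ : NonZero Lᵤ}} where

  open Blocks using (Rows)

  Constrained : Set
  Constrained = Σ (MacMahon a b) (λ Υ → Irrelevant (RowCondition rᵤ Lᵤ Dᵤ (unmarkedRows Υ) × RowCondition rₘ Lₘ Dₘ (markedRows Υ)))

  Constrained↔Rows : rᵤ * Lᵤ + rₘ * Lₘ ≡ b → Constrained ↔ (Rows Lₘ Dₘ a rₘ × Rows Lᵤ Dᵤ a rᵤ)
  Constrained↔Rows counts = ↔-trans (Σ-restrict MacMahon↔RowPairs _) split
    where
    split : Σ (RowPairs a b) (λ ((ν , μ) , _) → Irrelevant (RowCondition rᵤ Lᵤ Dᵤ μ × RowCondition rₘ Lₘ Dₘ ν)) ↔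
            (Rows Lₘ Dₘ a rₘ × Rows Lᵤ Dᵤ a rᵤ)
    split = mk↔ₛ′
      (λ (((ν , μ) , [ p ]) , [ q ]) → (ν , [ proj₁ p , proj₁ (proj₂ (proj₂ p)) , proj₂ q ]) ,
                                      (μ , [ proj₁ (proj₂ p) , proj₁ (proj₂ (proj₂ (proj₂ p))) , proj₁ q ]))
      (λ ((ν , [ x ]) , (μ , [ y ])) →
        ((ν , μ) , [ proj₁ x , proj₁ y , proj₁ (proj₂ x) , proj₁ (proj₂ y) ,
                     trans (cong₂ _+_ (proj₁ (proj₂ (proj₂ y))) (proj₁ (proj₂ (proj₂ x)))) counts ]) ,
        [ proj₂ (proj₂ y) , proj₂ (proj₂ x) ])
      (λ _ → refl) (λ _ → refl)

  Constrained↔Rows-size : ∀ counts Υ → sum (proj₁ (proj₁ (Inverse.to (Constrained↔Rows counts) Υ))) +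
                                       sum (proj₁ (proj₂ (Inverse.to (Constrained↔Rows counts) Υ))) ≡ size (proj₁ Υ)
  Constrained↔Rows-size _ (Υ , _) = sym (size≡marked+unmarked Υ)

  Constrained-HasGF : (counts : rᵤ * Lᵤ + rₘ * Lₘ ≡ b) → 1 ≤ Dₘ → 1 ≤ Dᵤ →
    (fitsₘ : Dₘ * Lₘ * (rₘ ∸ 1) ≤ a * Lₘ) → (fitsᵤ : Dᵤ * Lᵤ * (rᵤ ∸ 1) ≤ a * Lᵤ) →
    HasGF Constrained (size ∘ proj₁)
      (shiftP (Dₘ * Lₘ * (rₘ C 2) + Dᵤ * Lᵤ * (rᵤ C 2))
              (gauss (a * Lₘ ∸ Dₘ * Lₘ * (rₘ ∸ 1) + rₘ) rₘ *P (gauss (a * Lᵤ ∸ Dᵤ * Lᵤ * (rᵤ ∸ 1) + rᵤ) rᵤ *P oneP)))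
  Constrained-HasGF counts 1≤Dₘ 1≤Dᵤ fitsₘ fitsᵤ =
    HasGF-↔ (Constrained↔Rows counts) (Constrained↔Rows-size counts)
      (HasGF-↔ boxes boxes-size
        (HasGF-shift (eₘ + eᵤ) (HasGF-× (gauss-counts-Box _ rₘ) (HasGF-× (gauss-counts-Box _ rᵤ) HasGF-⊤))))
    where
    eₘ = Dₘ * Lₘ * (rₘ C 2)
    eᵤ = Dᵤ * Lᵤ * (rᵤ C 2)
    boxₘ = Rows↔Box Lₘ Dₘ a rₘ 1≤Dₘ fitsₘ
    boxᵤ = Rows↔Box Lᵤ Dᵤ a rᵤ 1≤Dᵤ fitsᵤ
    boxes = boxₘ ×-↔ ↔-trans boxᵤ ↔-×-⊤
    boxes-size : ∀ ((μ , ν) : Rows Lₘ Dₘ a rₘ × Rows Lᵤ Dᵤ a rᵤ) →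
                 eₘ + eᵤ + (Box-size (Inverse.to boxₘ μ) + (Box-size (Inverse.to boxᵤ ν) + 0)) ≡ sum (proj₁ μ) + sum (proj₁ ν)
    boxes-size (μ , ν) = trans (regroup eₘ eᵤ _ _)
      (cong₂ _+_ (Rows↔Box-size Lₘ Dₘ a rₘ 1≤Dₘ fitsₘ μ) (Rows↔Box-size Lᵤ Dᵤ a rᵤ 1≤Dᵤ fitsᵤ ν))
      where
      regroup : ∀ e e′ x y → e + e′ + (x + (y + 0)) ≡ e + x + (e′ + y)
      regroup = solve-∀

  Constrained-emptyₘ : (counts : rᵤ * Lᵤ + rₘ * Lₘ ≡ b) → 1 ≤ Dₘ → 1 ≤ rₘ → a * Lₘ < Dₘ * Lₘ * (rₘ ∸ 1) → ¬ Constrained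
  Constrained-emptyₘ counts 1≤D 1≤r overfull Υ =
    Rows-empty Lₘ Dₘ a rₘ 1≤D 1≤r overfull (proj₁ (Inverse.to (Constrained↔Rows counts) Υ))

  Constrained-emptyᵤ : (counts : rᵤ * Lᵤ + rₘ * Lₘ ≡ b) → 1 ≤ Dᵤ → 1 ≤ rᵤ → a * Lᵤ < Dᵤ * Lᵤ * (rᵤ ∸ 1) → ¬ Constrained
  Constrained-emptyᵤ counts 1≤D 1≤r overfull Υ =
    Rows-empty Lᵤ Dᵤ a rᵤ 1≤D 1≤r overfull (proj₂ (Inverse.to (Constrained↔Rows counts) Υ))

-- The polynomial F for two rectangles

ℤ-∸-∸ : ∀ X y₁ y₂ → (pos X ℤ.- pos y₁) ℤ.- pos y₂ ≡ X ⊖ (y₁ + y₂)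
ℤ-∸-∸ X y₁ y₂ = begin
  (pos X ℤ.- pos y₁) ℤ.- pos y₂      ≡⟨ ℤₚ.+-assoc (pos X) (ℤ.- pos y₁) (ℤ.- pos y₂) ⟩
  pos X ℤ.+ (ℤ.- pos y₁ ℤ.- pos y₂) ≡⟨ cong (λ z → pos X ℤ.+ z) (sym (ℤₚ.neg-distrib-+ (pos y₁) (pos y₂))) ⟩
  pos X ℤ.- (pos y₁ ℤ.+ pos y₂)     ≡⟨ cong (λ z → pos X ℤ.- z) (sym (ℤₚ.pos-+ y₁ y₂)) ⟩
  pos X ℤ.- pos (y₁ + y₂)           ≡⟨ ℤₚ.m-n≡m⊖n X (y₁ + y₂) ⟩
  X ⊖ (y₁ + y₂)                     ∎
  where open ≡-Reasoning

-- X + G ≡ K + (Y + k) says X − Y = (K − G) + k without truncated subtraction; the sign of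
-- K − G decides whether the factor is a Gaussian polynomial or vanishes.
gaussℤ-⊖ : ∀ {X Y G K} k → X + G ≡ K + (Y + k) → G ≤ K → gaussℤ (X ⊖ Y) k ≡ gauss (K ∸ G + k) k
gaussℤ-⊖ {X} {Y} {G} {K} k X+G≡ G≤K = cong (λ z → gaussℤ z k) (trans (ℤₚ.⊖-≥ Y≤X) (cong pos (trans (cong (_∸ Y) X≡) (m+n∸n≡m _ Y))))
  where
  X≡ : X ≡ K ∸ G + k + Y
  X≡ = +-cancelʳ-≡ G X (K ∸ G + k + Y) (trans X+G≡ (trans (cong (_+ (Y + k)) (sym (m∸n+n≡m G≤K))) (regroup (K ∸ G) G Y k)))
    where
    regroup : ∀ a g y k → a + g + (y + k) ≡ a + k + y + g
    regroup = solve-∀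
  Y≤X : Y ≤ X
  Y≤X = subst (Y ≤_) (sym X≡) (m≤n+m Y _)

gaussℤ-⊖-zero : ∀ {X Y G K} k → 1 ≤ k → X + G ≡ K + (Y + k) → K < G → ∀ n → gaussℤ (X ⊖ Y) k n ≡ 0
gaussℤ-⊖-zero {X} {Y} {G} {K} (suc k) _ X+G≡ K<G n with Y ≤? X
... | yes Y≤X rewrite ℤₚ.⊖-≥ Y≤X = gauss-< X∸Y<k n
  where
  X<Y+k : X < Y + suc k
  X<Y+k = +-cancelʳ-< G X (Y + suc k)
    (subst (_< Y + suc k + G) (sym X+G≡) (subst (K + (Y + suc k) <_) (+-comm G (Y + suc k)) (+-monoˡ-< (Y + suc k) K<G)))
  X∸Y<k : X ∸ Y < suc k
  X∸Y<k = +-cancelˡ-< Y (X ∸ Y) (suc k) (subst (_< Y + suc k) (sym (m+[n∸m]≡n Y≤X)) X<Y+k)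
... | no Y≰X rewrite ℤₚ.⊖-< (≰⇒> Y≰X) with Y ∸ X | m>n⇒m∸n≢0 (≰⇒> Y≰X)
...   | zero  | Y∸X≢0 = ⊥-elim (Y∸X≢0 refl)
...   | suc _ | _     = refl

factorTop : ℕ → List ℕ → ℕ → ℤ
factorTop a λs j = (pos (j * (a + 2)) ℤ.- pos (Y λs (j ∸ 1))) ℤ.- pos (Y λs (suc j))

factor : ℕ → List ℕ → ℕ → Poly
factor a λs j = gaussℤ (factorTop a λs j) ((λs ! j) ∸ (λs ! suc j))

F≡shiftP-prodP : ∀ a λs n → F a λs n ≡ shiftP (2 * sum (map (_C 2) λs)) (prodP (map (factor a λs ∘ suc) (upTo (length λs)))) n
F≡shiftP-prodP _ _ _ = refl

gaussℤ-0 : ∀ z → gaussℤ z 0 ≡ oneP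
gaussℤ-0 (pos _)  = refl
gaussℤ-0 ℤ.-[1+ _ ] = refl

factor-flat : ∀ a λs j → λs ! j ≡ λs ! suc j → ∀ n → factor a λs j n ≡ oneP n
factor-flat a λs j flat n = cong (_$ n) (trans (cong (gaussℤ (factorTop a λs j)) (trans (cong (_∸ λs ! suc j) flat) (n∸n≡0 (λs ! suc j))))
                                               (gaussℤ-0 (factorTop a λs j)))

prodP-two-factors : ∀ (h : ℕ → Poly) m k → (∀ i → i < m → ∀ n → h i n ≡ oneP n) → (∀ i → i < k → ∀ n → h (suc m + i) n ≡ oneP n) →
                    ∀ n → prodP (applyUpTo h (suc m + suc k)) n ≡ (h m *P (h (suc m + k) *P oneP)) n
prodP-two-factors h m k ones₁ ones₂ n = begin
  prodP (applyUpTo h (suc m + suc k)) n                            ≡⟨ cong (λ l → prodP (applyUpTo h l) n) length≡ ⟩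
  prodP (applyUpTo h (m + suc (k + 1))) n                          ≡⟨ prodP-drop-ones h m (suc (k + 1)) ones₁ n ⟩
  (h (m + 0) *P prodP (applyUpTo (λ i → h (m + suc i)) (k + 1))) n ≡⟨ *P-cong (λ j → cong (λ i → h i j) (+-identityʳ m)) rest n ⟩
  (h m *P (h (suc m + k) *P oneP)) n                               ∎
  where
  open ≡-Reasoning
  length≡ : suc m + suc k ≡ m + suc (k + 1)
  length≡ = trans (sym (+-suc m (suc k))) (cong (λ l → m + suc l) (+-comm 1 k))
  rest : ∀ j → prodP (applyUpTo (λ i → h (m + suc i)) (k + 1)) j ≡ (h (suc m + k) *P oneP) j
  rest j = trans (prodP-drop-ones (λ i → h (m + suc i)) k 1 (λ i i<k → subst (λ l → ∀ n → h l n ≡ oneP n) (sym (+-suc m i)) (ones₂ i i<k)) j)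
                 (*P-cong {g = oneP} (λ j′ → cong (λ i → h i j′) (trans (+-suc m (k + 0)) (cong suc (cong (m +_) (+-identityʳ k))))) (λ _ → refl) j)

!-beyond : ∀ (xs : List ℕ) {i} → length xs < i → xs ! i ≡ 0
!-beyond []       {zero}        _         = refl
!-beyond []       {suc i}       _         = refl
!-beyond (x ∷ xs) {suc (suc i)} (s≤s lt) = !-beyond xs lt

take-++-≤ : ∀ k (xs ys : List ℕ) → k ≤ length xs → take k (xs ++ ys) ≡ take k xs
take-++-≤ zero    xs       ys _         = refl
take-++-≤ (suc k) (x ∷ xs) ys (s≤s k≤) = cong (x ∷_) (take-++-≤ k xs ys k≤)

take-length-+-++ : ∀ k (xs ys : List ℕ) → take (length xs + k) (xs ++ ys) ≡ xs ++ take k ys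
take-length-+-++ k []       ys = refl
take-length-+-++ k (x ∷ xs) ys = cong (x ∷_) (take-length-+-++ k xs ys)

sum-take-replicate : ∀ k m (x : ℕ) → k ≤ m → sum (take k (replicate m x)) ≡ k * x
sum-take-replicate zero    m       x _        = refl
sum-take-replicate (suc k) (suc m) x (s≤s k≤m) = cong (x +_) (sum-take-replicate k m x k≤m)

module TwoRectangles (a t mt′ s ms′ : ℕ) where

  private
    mt ms L : ℕ
    mt = suc mt′
    ms = suc ms′
    L  = mt + ms
    λs = twoRect t mt s ms
    tops = replicate mt t

  length-twoRect : length λs ≡ L
  length-twoRect = trans (length-++ tops) (cong₂ _+_ (length-replicate mt) (length-replicate ms))

  Y-tops : ∀ {k} → k ≤ mt → Y λs k ≡ k * t
  Y-tops {k} k≤mt = trans (cong sum (take-++-≤ k tops _ (subst (k ≤_) (sym (length-replicate mt)) k≤mt)))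
                          (sum-take-replicate k mt t k≤mt)

  Y-beyond-tops : ∀ {k} → k ≤ ms → Y λs (mt + k) ≡ mt * t + k * s
  Y-beyond-tops {k} k≤ms = begin
    sum (take (mt + k) λs)                     ≡⟨ cong (λ l → sum (take (l + k) λs)) (sym (length-replicate mt)) ⟩
    sum (take (length tops + k) λs)            ≡⟨ cong sum (take-length-+-++ k tops _) ⟩
    sum (tops ++ take k (replicate ms s))      ≡⟨ sum-++ tops _ ⟩
    sum tops + sum (take k (replicate ms s))   ≡⟨ cong₂ _+_ (sum-replicate mt t) (sum-take-replicate k ms s k≤ms) ⟩
    mt * t + k * s                             ∎
    where open ≡-Reasoning

  Y-all : Y λs (suc L) ≡ mt * t + ms * s
  Y-all = trans (cong sum (take-all (suc L) λs (≤-trans (≤-reflexive length-twoRect) (n≤1+n L))))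
                (trans (sum-++ tops _) (cong₂ _+_ (sum-replicate mt t) (sum-replicate ms s)))

  twoRect-!-top : ∀ {j} → 1 ≤ j → j ≤ mt → λs ! j ≡ t
  twoRect-!-top = replicate-++-!ˡ mt (replicate ms s)

  twoRect-!-bottom : ∀ {k} → 1 ≤ k → k ≤ ms → λs ! (mt + k) ≡ s
  twoRect-!-bottom {k} 1≤k k≤ms = begin
    λs ! (mt + k)                   ≡⟨ cong (λ l → λs ! (l + k)) (sym (length-replicate mt)) ⟩
    λs ! (length tops + k)          ≡⟨ !-++ʳ tops _ 1≤k ⟩
    replicate ms s ! k              ≡⟨ replicate-! ms 1≤k k≤ms ⟩
    s                               ∎
    where open ≡-Reasoning

  twoRect-!-beyond : λs ! suc L ≡ 0
  twoRect-!-beyond = !-beyond λs (s≤s (≤-reflexive length-twoRect))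

  factor-tops : ∀ i → i < mt′ → ∀ n → factor a λs (suc i) n ≡ oneP n
  factor-tops i i<mt′ = factor-flat a λs (suc i)
    (trans (twoRect-!-top (s≤s z≤n) (s≤s (<⇒≤ i<mt′))) (sym (twoRect-!-top (s≤s z≤n) (s≤s i<mt′))))

  factor-bottoms : ∀ i → i < ms′ → ∀ n → factor a λs (suc mt + i) n ≡ oneP n
  factor-bottoms i i<ms′ = factor-flat a λs (suc mt + i) (begin
    λs ! suc (mt + i)       ≡⟨ cong (λs !_) (sym (+-suc mt i)) ⟩
    λs ! (mt + suc i)       ≡⟨ twoRect-!-bottom (s≤s z≤n) (s≤s (<⇒≤ i<ms′)) ⟩
    s                       ≡⟨ sym (twoRect-!-bottom (s≤s z≤n) (s≤s i<ms′)) ⟩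
    λs ! (mt + suc (suc i)) ≡⟨ cong (λs !_) (trans (+-suc mt (suc i)) (cong suc (+-suc mt i))) ⟩
    λs ! suc (suc (mt + i)) ∎)
    where open ≡-Reasoning

  F-twoRect : ∀ n → F a λs n ≡ shiftP (2 * sum (map (_C 2) λs)) (factor a λs mt *P (factor a λs L *P oneP)) n
  F-twoRect n = begin
    F a λs n ≡⟨ F≡shiftP-prodP a λs n ⟩
    shiftP E (prodP (map (factor a λs ∘ suc) (upTo (length λs)))) n
      ≡⟨ shiftP-cong {E} {E} {prodP (map (factor a λs ∘ suc) (upTo (length λs)))} refl product n ⟩
    shiftP E (factor a λs mt *P (factor a λs L *P oneP)) n ∎
    where
    open ≡-Reasoning
    E = 2 * sum (map (_C 2) λs)
    product : ∀ j → prodP (map (factor a λs ∘ suc) (upTo (length λs))) j ≡ (factor a λs mt *P (factor a λs L *P oneP)) j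
    product j = begin
      prodP (map (factor a λs ∘ suc) (upTo (length λs))) j
        ≡⟨ cong (λ fs → prodP fs j) (trans (map-upTo (factor a λs ∘ suc) (length λs)) (cong (applyUpTo (factor a λs ∘ suc)) length-twoRect)) ⟩
      prodP (applyUpTo (factor a λs ∘ suc) L) j ≡⟨ prodP-two-factors (factor a λs ∘ suc) mt′ ms′ factor-tops factor-bottoms j ⟩
      (factor a λs mt *P (factor a λs (suc (mt + ms′)) *P oneP)) j
        ≡⟨ *P-cong {f = factor a λs mt} (λ _ → refl) (*P-cong {g = oneP} (λ i → cong (λ l → factor a λs l i) (sym (+-suc mt ms′))) (λ _ → refl)) j ⟩
      (factor a λs mt *P (factor a λs L *P oneP)) j ∎

  factor-corner-top : factor a λs mt ≡ gaussℤ ((mt * (a + 2)) ⊖ (mt′ * t + (mt * t + s))) (t ∸ s)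
  factor-corner-top = cong₂ gaussℤ
    (trans (ℤ-∸-∸ (mt * (a + 2)) (Y λs mt′) (Y λs (suc mt))) (cong ((mt * (a + 2)) ⊖_) (cong₂ _+_ (Y-tops (n≤1+n mt′)) Y-next)))
    (cong₂ _∸_ (twoRect-!-top (s≤s z≤n) ≤-refl) (trans (cong (λs !_) (+-comm 1 mt)) (twoRect-!-bottom ≤-refl (s≤s z≤n))))
    where
    Y-next : Y λs (suc mt) ≡ mt * t + s
    Y-next = trans (cong (Y λs) (+-comm 1 mt)) (trans (Y-beyond-tops (s≤s z≤n)) (cong (mt * t +_) (+-identityʳ s)))

  factor-corner-bottom : factor a λs L ≡ gaussℤ ((L * (a + 2)) ⊖ ((mt * t + ms′ * s) + (mt * t + ms * s))) s
  factor-corner-bottom = cong₂ gaussℤ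
    (trans (ℤ-∸-∸ (L * (a + 2)) (Y λs (mt′ + ms)) (Y λs (suc L)))
      (cong ((L * (a + 2)) ⊖_) (cong₂ _+_ (trans (cong (Y λs) (+-suc mt′ ms′)) (Y-beyond-tops (n≤1+n ms′)))
                                          Y-all)))
    (trans (cong (_∸ λs ! suc L) (twoRect-!-bottom (s≤s z≤n) ≤-refl)) (cong (s ∸_) twoRect-!-beyond))

  sum-C2-twoRect : sum (map (_C 2) λs) ≡ mt * (t C 2) + ms * (s C 2)
  sum-C2-twoRect = begin
    sum (map (_C 2) λs)                                          ≡⟨ cong sum (map-++ (_C 2) tops (replicate ms s)) ⟩
    sum (map (_C 2) tops ++ map (_C 2) (replicate ms s))         ≡⟨ sum-++ (map (_C 2) tops) _ ⟩
    sum (map (_C 2) tops) + sum (map (_C 2) (replicate ms s))    ≡⟨ cong₂ _+_ (sum-map-replicate mt t) (sum-map-replicate ms s) ⟩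
    mt * (t C 2) + ms * (s C 2)                                  ∎
    where
    open ≡-Reasoning
    sum-map-replicate : ∀ n x → sum (map (_C 2) (replicate n x)) ≡ n * (x C 2)
    sum-map-replicate n x = trans (cong sum (map-replicate (_C 2) n x)) (sum-replicate n (x C 2))

  private
    Yₘ Yᵤ : ℕ
    Yₘ = mt′ * t + (mt * t + s)
    Yᵤ = (mt * t + ms′ * s) + (mt * t + ms * s)

  F-twoRect-fits : ∀ {Gₘ Gᵤ e} → 2 * sum (map (_C 2) λs) ≡ e →
    mt * (a + 2) + Gₘ ≡ a * mt + (Yₘ + (t ∸ s)) → Gₘ ≤ a * mt →
    L * (a + 2) + Gᵤ ≡ a * L + (Yᵤ + s) → Gᵤ ≤ a * L →
    ∀ n → F a λs n ≡ shiftP e (gauss (a * mt ∸ Gₘ + (t ∸ s)) (t ∸ s) *P (gauss (a * L ∸ Gᵤ + s) s *P oneP)) n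
  F-twoRect-fits {Gₘ} {Gᵤ} e≡ topₘ fitsₘ topᵤ fitsᵤ n =
    trans (F-twoRect n) (shiftP-cong e≡ (*P-cong cornerₘ (*P-cong {g = oneP} cornerᵤ λ _ → refl)) n)
    where
    cornerₘ : ∀ k → factor a λs mt k ≡ gauss (a * mt ∸ Gₘ + (t ∸ s)) (t ∸ s) k
    cornerₘ k = cong (_$ k) (trans factor-corner-top (gaussℤ-⊖ (t ∸ s) topₘ fitsₘ))
    cornerᵤ : ∀ k → factor a λs L k ≡ gauss (a * L ∸ Gᵤ + s) s k
    cornerᵤ k = cong (_$ k) (trans factor-corner-bottom (gaussℤ-⊖ s topᵤ fitsᵤ))

  F-twoRect-overfullₘ : ∀ {Gₘ} → 1 ≤ t ∸ s → mt * (a + 2) + Gₘ ≡ a * mt + (Yₘ + (t ∸ s)) → a * mt < Gₘ → ∀ n → F a λs n ≡ 0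
  F-twoRect-overfullₘ 1≤p topₘ overfull n =
    trans (F-twoRect n) (shiftP-zero (2 * sum (map (_C 2) λs)) _ (*P-zeroˡ (factor a λs mt) (factor a λs L *P oneP) vanishes) n)
    where
    vanishes : ∀ k → factor a λs mt k ≡ 0
    vanishes k = trans (cong (_$ k) factor-corner-top) (gaussℤ-⊖-zero (t ∸ s) 1≤p topₘ overfull k)

  F-twoRect-overfullᵤ : ∀ {Gᵤ} → 1 ≤ s → L * (a + 2) + Gᵤ ≡ a * L + (Yᵤ + s) → a * L < Gᵤ → ∀ n → F a λs n ≡ 0
  F-twoRect-overfullᵤ 1≤s topᵤ overfull n =
    trans (F-twoRect n) (shiftP-zero (2 * sum (map (_C 2) λs)) _
      (*P-zeroʳ (factor a λs mt) (factor a λs L *P oneP) (*P-zeroˡ (factor a λs L) oneP vanishes)) n)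
    where
    vanishes : ∀ k → factor a λs L k ≡ 0
    vanishes k = trans (cong (_$ k) factor-corner-bottom) (gaussℤ-⊖-zero s 1≤s topᵤ overfull k)

-- Arithmetic of the hypotheses on A and B

2*nC2≡n*[n∸1] : ∀ n → 2 * (n C 2) ≡ n * (n ∸ 1)
2*nC2≡n*[n∸1] zero    = refl
2*nC2≡n*[n∸1] (suc n) = begin
  2 * (suc n C 2)          ≡⟨ cong (2 *_) (sym (n+nC2≡[1+n]C2 n)) ⟩
  2 * (n + n C 2)          ≡⟨ *-distribˡ-+ 2 n (n C 2) ⟩
  2 * n + 2 * (n C 2)      ≡⟨ cong (2 * n +_) (2*nC2≡n*[n∸1] n) ⟩
  2 * n + n * (n ∸ 1)      ≡⟨ step n ⟩
  suc n * n                ∎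
  where
  open ≡-Reasoning
  step : ∀ n → 2 * n + n * (n ∸ 1) ≡ suc n * n
  step zero    = refl
  step (suc n) = lemma n
    where
    lemma : ∀ n → 2 * suc n + suc n * n ≡ suc (suc n) * suc n
    lemma = solve-∀

m*n≡2*o⇒0<m : ∀ {m n o} → m * n ≡ 2 * o → 0 < o → 0 < m
m*n≡2*o⇒0<m {zero}  {_} {suc _} () _
m*n≡2*o⇒0<m {suc _} _ _ = z<s

[1+t]*m+[1+s]*n∸[m+n]≡t*m+s*n : ∀ t s m n → (suc t * m + suc s * n) ∸ (m + n) ≡ t * m + s * n
[1+t]*m+[1+s]*n∸[m+n]≡t*m+s*n t s m n = trans (cong (_∸ (m + n)) (regroup t s m n)) (m+n∸m≡n (m + n) (t * m + s * n))
  where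
  regroup : ∀ t s m n → suc t * m + suc s * n ≡ (m + n) + (t * m + s * n)
  regroup = solve-∀

m+n<t*m+s*n : ∀ {t s m n} .{{_ : NonZero m}} → 1 < t → 1 ≤ s → m + n < t * m + s * n
m+n<t*m+s*n {t} {s} {m} {n} 1<t 1≤s =
  +-mono-<-≤ (subst (m <_) (*-comm m t) (m<m*n m t 1<t)) (subst (n ≤_) (*-comm n s) (m≤m*n n s {{>-nonZero 1≤s}}))

marked-corner-arithmetic : ∀ a mt′ s p A {t} → s + p ≡ t → 1 ≤ s → 1 ≤ p → A * (p ∸ 1) ≡ 2 * (t ∸ 1) →
  suc mt′ * (a + 2) + A * suc mt′ * (p ∸ 1) ≡ a * suc mt′ + ((mt′ * t + (suc mt′ * t + s)) + p)
marked-corner-arithmetic a mt′ (suc s′) (suc p′) A refl _ _ hA = begin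
  mt * (a + 2) + A * mt * p′               ≡⟨ cong (mt * (a + 2) +_) (trans (*-comm-middle A mt p′) (cong (mt *_) hA)) ⟩
  mt * (a + 2) + mt * (2 * (s′ + suc p′))  ≡⟨ identity a mt′ s′ p′ ⟩
  a * mt + ((mt′ * t + (mt * t + suc s′)) + suc p′) ∎
  where
  open ≡-Reasoning
  mt = suc mt′
  t = suc s′ + suc p′
  *-comm-middle : ∀ x y z → x * y * z ≡ y * (x * z)
  *-comm-middle = solve-∀
  identity : ∀ a mt′ s′ p′ → suc mt′ * (a + 2) + suc mt′ * (2 * (s′ + suc p′)) ≡
             a * suc mt′ + ((mt′ * (suc s′ + suc p′) + (suc mt′ * (suc s′ + suc p′) + suc s′)) + suc p′)
  identity = solve-∀

unmarked-corner-arithmetic : ∀ a mt′ ms′ s B {t} → 1 ≤ t → 1 ≤ s →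
  B * ((suc mt′ + suc ms′) * (s ∸ 1)) ≡ 2 * ((t * suc mt′ + s * suc ms′) ∸ (suc mt′ + suc ms′)) →
  (suc mt′ + suc ms′) * (a + 2) + B * (suc mt′ + suc ms′) * (s ∸ 1) ≡
    a * (suc mt′ + suc ms′) + (((suc mt′ * t + ms′ * s) + (suc mt′ * t + suc ms′ * s)) + s)
unmarked-corner-arithmetic a mt′ ms′ (suc s′) B {suc t′} _ _ hB = begin
  L * (a + 2) + B * L * s′                         ≡⟨ cong (L * (a + 2) +_) (*-assoc B L s′) ⟩
  L * (a + 2) + B * (L * s′)
    ≡⟨ cong (L * (a + 2) +_) (trans hB (cong (2 *_) ([1+t]*m+[1+s]*n∸[m+n]≡t*m+s*n t′ s′ (suc mt′) (suc ms′)))) ⟩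
  L * (a + 2) + 2 * (t′ * suc mt′ + s′ * suc ms′)   ≡⟨ identity a mt′ ms′ t′ s′ ⟩
  a * L + (((suc mt′ * suc t′ + ms′ * suc s′) + (suc mt′ * suc t′ + suc ms′ * suc s′)) + suc s′) ∎
  where
  open ≡-Reasoning
  L = suc mt′ + suc ms′
  identity : ∀ a mt′ ms′ t′ s′ → (suc mt′ + suc ms′) * (a + 2) + 2 * (t′ * suc mt′ + s′ * suc ms′) ≡
             a * (suc mt′ + suc ms′) + (((suc mt′ * suc t′ + ms′ * suc s′) + (suc mt′ * suc t′ + suc ms′ * suc s′)) + suc s′)
  identity = solve-∀

shift-arithmetic : ∀ mt ms s p A B {t} → s + p ≡ t → 1 ≤ s → A * (p ∸ 1) ≡ 2 * (t ∸ 1) →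
  B * ((mt + ms) * (s ∸ 1)) ≡ 2 * ((t * mt + s * ms) ∸ (mt + ms)) →
  2 * (mt * (t C 2) + ms * (s C 2)) ≡ A * mt * (p C 2) + B * (mt + ms) * (s C 2)
shift-arithmetic mt ms (suc s′) p A B refl _ hA hB = begin
  2 * (mt * (t C 2) + ms * (s C 2))               ≡⟨ distribute mt ms (t C 2) (s C 2) ⟩
  mt * (2 * (t C 2)) + ms * (2 * (s C 2))         ≡⟨ cong₂ (λ u w → mt * u + ms * w) (2*nC2≡n*[n∸1] t) (2*nC2≡n*[n∸1] s) ⟩
  mt * (t * t′) + ms * (s * s′)                   ≡⟨ identity mt ms s′ p ⟩
  mt * p * t′ + s * (t′ * mt + s′ * ms)           ≡⟨ sym (cong₂ _+_ marked-shift unmarked-shift) ⟩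
  A * mt * (p C 2) + B * (mt + ms) * (s C 2)      ∎
  where
  open ≡-Reasoning
  s = suc s′
  t = s + p
  t′ = s′ + p
  distribute : ∀ m n x y → 2 * (m * x + n * y) ≡ m * (2 * x) + n * (2 * y)
  distribute = solve-∀
  identity : ∀ mt ms s′ p → mt * ((suc s′ + p) * (s′ + p)) + ms * (suc s′ * s′) ≡
             mt * p * (s′ + p) + suc s′ * ((s′ + p) * mt + s′ * ms)
  identity = solve-∀
  2-inside : ∀ x y z → 2 * (x * y * z) ≡ x * y * (2 * z)
  2-inside = solve-∀
  2-outside : ∀ x y → x * (2 * y) ≡ 2 * (x * y)
  2-outside = solve-∀
  marked-shift : A * mt * (p C 2) ≡ mt * p * t′
  marked-shift = *-cancelˡ-≡ _ _ 2 (begin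
    2 * (A * mt * (p C 2))  ≡⟨ 2-inside A mt (p C 2) ⟩
    A * mt * (2 * (p C 2))  ≡⟨ cong (A * mt *_) (2*nC2≡n*[n∸1] p) ⟩
    A * mt * (p * (p ∸ 1))  ≡⟨ regroup A mt p (p ∸ 1) ⟩
    mt * p * (A * (p ∸ 1))  ≡⟨ cong (mt * p *_) hA ⟩
    mt * p * (2 * t′)       ≡⟨ 2-outside (mt * p) t′ ⟩
    2 * (mt * p * t′)       ∎)
    where
    regroup : ∀ a m p q → a * m * (p * q) ≡ m * p * (a * q)
    regroup = solve-∀
  unmarked-shift : B * (mt + ms) * (s C 2) ≡ s * (t′ * mt + s′ * ms)
  unmarked-shift = *-cancelˡ-≡ _ _ 2 (begin
    2 * (B * (mt + ms) * (s C 2))   ≡⟨ 2-inside B (mt + ms) (s C 2) ⟩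
    B * (mt + ms) * (2 * (s C 2))   ≡⟨ cong (B * (mt + ms) *_) (2*nC2≡n*[n∸1] s) ⟩
    B * (mt + ms) * (s * s′)        ≡⟨ regroup B (mt + ms) s s′ ⟩
    s * (B * ((mt + ms) * s′))      ≡⟨ cong (s *_) (trans hB (cong (2 *_) ([1+t]*m+[1+s]*n∸[m+n]≡t*m+s*n t′ s′ mt ms))) ⟩
    s * (2 * (t′ * mt + s′ * ms))   ≡⟨ 2-outside s (t′ * mt + s′ * ms) ⟩
    2 * (s * (t′ * mt + s′ * ms))   ∎)
    where
    regroup : ∀ b l s q → b * l * (s * q) ≡ s * (b * (l * q))
    regroup = solve-∀

row-count-arithmetic : ∀ mt ms s p {t} → s + p ≡ t → s * (mt + ms) + p * mt ≡ t * mt + s * ms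
row-count-arithmetic mt ms s p refl = identity s p mt ms
  where
  identity : ∀ s p mt ms → s * (mt + ms) + p * mt ≡ (s + p) * mt + s * ms
  identity = solve-∀


corollary3p12 : (a b t s mt ms : ℕ) → 1 ≤ a → 1 ≤ b → 1 ≤ t → 1 ≤ s → 1 ≤ mt → 1 ≤ ms →
    t * mt + s * ms ≡ b → s + 1 < t → 1 < s →
    (A B : ℕ) → A * (t ∸ s ∸ 1) ≡ 2 * (t ∸ 1) →
    B * ((mt + ms) * (s ∸ 1)) ≡ 2 * (b ∸ (mt + ms)) →
    (n : ℕ) →
    Fin (F a (twoRect t mt s ms) n) ↔
      Σ (MacMahon a b) (λ Υ → Irrelevant ((size Υ ≡ n) ×
          RowCondition s (mt + ms) B (unmarkedRows Υ) ×
          RowCondition (t ∸ s) mt A (markedRows Υ)))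
corollary3p12 a b t s (suc mt′) (suc ms′) _ _ 1≤t 1≤s _ _ tb s+1<t 1<s A B hA hB n =
  ↔-sym (↔-trans (Σ-×↔Fiber size _ n) (count (A * mt * (p ∸ 1) ≤? a * mt) (B * L * (s ∸ 1) ≤? a * L)))
  where
  mt = suc mt′
  L  = mt + suc ms′
  p  = t ∸ s
  s+p≡t : s + p ≡ t
  s+p≡t = m+[n∸m]≡n (≤-trans (m≤m+n s 1) (<⇒≤ s+1<t))
  1≤p : 1 ≤ p
  1≤p = m<n⇒0<n∸m (≤-trans (s≤s (m≤m+n s 1)) s+1<t)
  hB′ : B * (L * (s ∸ 1)) ≡ 2 * ((t * mt + s * suc ms′) ∸ L)
  hB′ = trans hB (cong (λ b → 2 * (b ∸ L)) (sym tb))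
  1<t : 1 < t
  1<t = <-trans 1<s (≤-trans (s≤s (m≤m+n s 1)) s+1<t)
  1≤A : 1 ≤ A
  1≤A = m*n≡2*o⇒0<m hA (m<n⇒0<n∸m 1<t)
  1≤B : 1 ≤ B
  1≤B = m*n≡2*o⇒0<m hB′ (m<n⇒0<n∸m (m+n<t*m+s*n 1<t 1≤s))
  counts : s * L + p * mt ≡ b
  counts = trans (row-count-arithmetic mt (suc ms′) s p s+p≡t) tb
  open ConstrainedDiagrams a b p mt A s L B
  open TwoRectangles a t mt′ s ms′
  topₘ = marked-corner-arithmetic a mt′ s p A s+p≡t 1≤s 1≤p hA
  topᵤ = unmarked-corner-arithmetic a mt′ ms′ s B 1≤t 1≤s hB′
  shift = trans (cong (2 *_) sum-C2-twoRect) (shift-arithmetic mt (suc ms′) s p A B s+p≡t 1≤s hA hB′)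
  count : Dec (A * mt * (p ∸ 1) ≤ a * mt) → Dec (B * L * (s ∸ 1) ≤ a * L) →
          Fiber Constrained (size ∘ proj₁) n ↔ Fin (F a (twoRect t mt s (suc ms′)) n)
  count (yes fitsₘ) (yes fitsᵤ) =
    ↔-trans (Constrained-HasGF counts 1≤A 1≤B fitsₘ fitsᵤ n) (Fin-cong (sym (F-twoRect-fits shift topₘ fitsₘ topᵤ fitsᵤ n)))
  count (no ¬fitsₘ) _ =
    ¬⇒↔Fin (Constrained-emptyₘ counts 1≤A 1≤p (≰⇒> ¬fitsₘ) ∘ proj₁) (F-twoRect-overfullₘ 1≤p topₘ (≰⇒> ¬fitsₘ) n)
  count _ (no ¬fitsᵤ) =
    ¬⇒↔Fin (Constrained-emptyᵤ counts 1≤B 1≤s (≰⇒> ¬fitsᵤ) ∘ proj₁) (F-twoRect-overfullᵤ 1≤s topᵤ (≰⇒> ¬fitsᵤ) n)
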